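{- Let $p,q$ be positive integers, and let $\alpha,\beta$ be integers with $0\le\alpha<p$ and $0\le\beta<q$. In the complete split graph $\mathrm{SPK}_{p,q}$ with clique vertices $x_1,\dots,x_p$ and independent vertices $y_1,\dots,y_q$, let $T_1$ be the search tree associated with the ordering $$x_1,\dots,x_\alpha,y_1,\dots,y_q,x_{\alpha+1},\dots,x_p$$ and $T_2$ the search tree associated with the ordering $$y_q,y_{q-1},\dots,y_{\beta+1},x_p,y_\beta,\dots,y_1,x_{p-1},\dots,x_1.$$ Then $$\mathrm{dist}(T_1,T_2)\ge\binom{p}{2}+\alpha q+\min\left\{\binom{q}{2}+\beta,\ 2q(p-\alpha)-\beta\right\}.$$
   Context: The complete split graph $\mathrm{SPK}_{p,q}$ has vertex set $P\cup Q$, $P=\{x_1,\dots,x_p\}$, $Q=\{y_1,\dots,y_q\}$, where $P$ is a clique, $Q$ is an independent set, and every vertex of $P$ is adjacent to every vertex of $Q$. A search tree on a connected graph $G=(V,E)$ is a rooted tree with vertex set $V$ whose root is some $r\in V$ joined to the roots of search trees on each connected component of $G-r$. The search tree associated with an ordering $v_1,\dots,v_n$ of $V$ has root $v_1$, and for each component $C$ of $G-v_1$, $v_1$ is joined to the root of the search tree on $G[C]$ associated with the restriction of the ordering to $C$. The tubes of a search tree are the vertex sets of its subtrees; two search trees are related by a rotation if their tube sets have symmetric difference of size exactly two. $\mathrm{dist}(T_1,T_2)$ is the minimum number of rotations transforming $T_1$ into $T_2$. -}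

module Defs where

open import Data.Nat as ℕ using (ℕ; zero; suc; _+_; _*_; _∸_; _≤_; _<_; _⊓_; _≤ᵇ_; _<ᵇ_)
open import Data.Bool using (Bool; true; false; _∧_; T)
open import Data.Fin using (Fin; toℕ; _↑ˡ_; _↑ʳ_; splitAt)
open import Data.Fin.Subset using (Subset; _∈_; _∉_; ⁅_⁆; _∪_; _∩_; _-_; Empty; ⊤)
open import Data.List using (List; []; _∷_; _++_; map; filter; length; reverse; allFin)
open import Data.List.Relation.Unary.All using (All)
open import Data.List.Relation.Unary.Any using (Any)
open import Data.List.Relation.Unary.AllPairs using (AllPairs)
open import Data.Vec.Properties using (≡-dec)
import Data.Bool.Properties as BoolP
import Data.List.Membership.DecPropositional as DecMem
open import Data.Maybe using (Maybe; just; nothing)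
open import Data.Product using (Σ; ∃; _×_; _,_)
open import Data.Sum using (_⊎_; inj₁; inj₂)
open import Data.Empty using (⊥)
open import Data.Unit using () renaming (⊤ to Unit)
open import Relation.Nullary using (¬_; ¬?)
open import Relation.Nullary.Decidable using (does)
open import Relation.Binary.PropositionalEquality using (_≡_)
open import Data.Nat.Combinatorics using (_C_)
open import Function.Bundles using (_⇔_)
import Data.Fin.Subset.Properties
import Data.Bool.Properties

data Reach {n : ℕ} (Adj : Fin n → Fin n → Set) (S : Subset n) (u : Fin n) : Fin n → Set where
  here : u ∈ S → Reach Adj S u u
  step : ∀ {w v} → Reach Adj S u w → Adj w v → v ∈ S → Reach Adj S u v

IsComponent : {n : ℕ} → (Fin n → Fin n → Set) → Subset n → Subset n → Set
IsComponent Adj S C =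
  (∃ λ u → u ∈ C) × (∀ u v → u ∈ C → (v ∈ C ⇔ Reach Adj S u v))

data Tree (n : ℕ) : Set where
  node : Fin n → List (Tree n) → Tree n

mutual
  vset : {n : ℕ} → Tree n → Subset n
  vset (node r ts) = ⁅ r ⁆ ∪ vsets ts

  vsets : {n : ℕ} → List (Tree n) → Subset n
  vsets []       = Data.Fin.Subset.⊥
  vsets (t ∷ ts) = vset t ∪ vsets ts

mutual
  tubes : {n : ℕ} → Tree n → List (Subset n)
  tubes (node r ts) = vset (node r ts) ∷ tubesL ts

  tubesL : {n : ℕ} → List (Tree n) → List (Subset n)
  tubesL []       = []
  tubesL (t ∷ ts) = tubes t ++ tubesL ts

ChildrenPartition : {n : ℕ} → (Fin n → Fin n → Set) → Subset n → Fin n → List (Tree n) → Set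
ChildrenPartition Adj S r ts =
  All (λ c → IsComponent Adj (S - r) (vset c)) ts
  × (∀ v → v ∈ (S - r) → Any (λ c → v ∈ vset c) ts)
  × AllPairs (λ a b → Empty (vset a ∩ vset b)) ts

data IsSearchTree {n : ℕ} (Adj : Fin n → Fin n → Set) : Subset n → Tree n → Set where
  st : ∀ {S r ts} → r ∈ S
     → All (λ c → IsSearchTree Adj (vset c) c) ts
     → ChildrenPartition Adj S r ts
     → IsSearchTree Adj S (node r ts)

firstIn : {n : ℕ} → List (Fin n) → Subset n → Maybe (Fin n)
firstIn []       S = nothing
firstIn (v ∷ vs) S with does (Data.Fin.Subset.Properties._∈?_ v S)
... | true  = just v
... | false = firstIn vs S

data Assoc {n : ℕ} (Adj : Fin n → Fin n → Set) (ord : List (Fin n)) : Subset n → Tree n → Set where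
  as : ∀ {S r ts} → r ∈ S → firstIn ord S ≡ just r
     → All (λ c → Assoc Adj ord (vset c) c) ts
     → ChildrenPartition Adj S r ts
     → Assoc Adj ord S (node r ts)

symDiffSize : {n : ℕ} → List (Subset n) → List (Subset n) → ℕ
symDiffSize {n} xs ys =
  length (filter (λ A → ¬? (A ∈? ys)) xs) + length (filter (λ A → ¬? (A ∈? xs)) ys)
  where open DecMem (≡-dec {n = n} BoolP._≟_) using (_∈?_)

Rotation : {n : ℕ} → Tree n → Tree n → Set
Rotation t u = symDiffSize (tubes t) (tubes u) ≡ 2

data RotPath {n : ℕ} (Adj : Fin n → Fin n → Set) : Tree n → Tree n → ℕ → Set where
  done : ∀ {t} → RotPath Adj t t 0
  next : ∀ {t u w k} → IsSearchTree Adj ⊤ u → Rotation t u → RotPath Adj u w k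
       → RotPath Adj t w (suc k)

DistAtLeast : {n : ℕ} → (Fin n → Fin n → Set) → Tree n → Tree n → ℕ → Set
DistAtLeast Adj t u k = ∀ m → RotPath Adj t u m → k ≤ m

-- The complete split graph SPK_{p,q} on Fin (p + q):
-- x_{i+1} = i ↑ˡ q  (i : Fin p), y_{j+1} = p ↑ʳ j  (j : Fin q).

xv : (p q : ℕ) → Fin p → Fin (p + q)
xv p q i = i ↑ˡ q

yv : (p q : ℕ) → Fin q → Fin (p + q)
yv p q j = p ↑ʳ j

SPKAdj : (p q : ℕ) → Fin (p + q) → Fin (p + q) → Set
SPKAdj p q u v with splitAt p u | splitAt p v
... | inj₁ i | inj₁ j = ¬ (i ≡ j)
... | inj₁ _ | inj₂ _ = Unit
... | inj₂ _ | inj₁ _ = Unit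
... | inj₂ _ | inj₂ _ = ⊥

-- x_{a+1}, ..., x_b  (1-based), i.e. 0-based indices a ≤ i < b, increasing.
xs : (p q : ℕ) → ℕ → ℕ → List (Fin (p + q))
xs p q a b = map (xv p q) (filter (λ i → Data.Bool.Properties.T? ((a ≤ᵇ toℕ i) ∧ (toℕ i <ᵇ b))) (allFin p))
  where import Data.Bool.Properties

-- y_{a+1}, ..., y_b  (1-based), increasing.
ys : (p q : ℕ) → ℕ → ℕ → List (Fin (p + q))
ys p q a b = map (yv p q) (filter (λ j → Data.Bool.Properties.T? ((a ≤ᵇ toℕ j) ∧ (toℕ j <ᵇ b))) (allFin q))
  where import Data.Bool.Properties

order1 : (p q α : ℕ) → List (Fin (p + q))
order1 p q α = xs p q 0 α ++ ys p q 0 q ++ xs p q α p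

order2 : (p q β : ℕ) → List (Fin (p + q))
order2 p q β = reverse (ys p q β q) ++ xs p q (p ∸ 1) p ++ reverse (ys p q 0 β) ++ reverse (xs p q 0 (p ∸ 1))

bound : (p q α β : ℕ) → ℕ
bound p q α β = p C 2 + α * q + ((q C 2 + β) ⊓ (2 * q * (p ∸ α) ∸ β))

{-# OPTIONS --safe #-}
-- For a set Z of independent vertices (the marks) let the potential Φ_Z(T) be the sum, over all
-- ancestor–descendant pairs (a, b) of T, of a cost c_Z(a, b) ∈ {0, 1, 2}, designed so that every
-- such pair of T₂ is free for a suitable Z₀ and so that c_Z(a, b) ≤ c_Z(b, a) + 1.  Call Z
-- admissible for T when every independent vertex that is a leaf of T is marked.  In SPK_{p,q} a
-- search tree is a path ending in a clique vertex, below which the remaining independent vertices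
-- hang as leaves; a case analysis of what one rotation does to such a tree shows that if Z is
-- admissible for T' and T is one rotation away, then some Z' admissible for T has
-- Φ_{Z'}(T) ≤ Φ_Z(T') + 1.  Walking a rotation path back from T₂ gives Φ_Z(T₁) ≤ dist(T₁, T₂) for
-- some Z.  Finally T₁ is a path, so Φ_Z(T₁) sums the costs of all pairs in the order of T₁, and
-- counting them block by block (clique/independent × clique/independent) bounds it below by the
-- stated expression for every Z; the two alternatives of the minimum correspond to Z having fewer
-- or at least 2(p − α) elements.
module Submission where

open import Defs
open import Data.Nat as ℕ using (ℕ; zero; suc; _+_; _*_; _∸_; _≤_; _<_; z≤n; s≤s; _≤ᵇ_; _<ᵇ_; _≡ᵇ_; _⊓_)
open import Data.Nat.Base using (s≤s⁻¹)
import Data.Nat.Properties as NP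
open import Data.Nat.Combinatorics using (_C_)
import Data.Nat.Combinatorics as NC
open import Data.Nat.Tactic.RingSolver using (solve-∀)
open import Algebra.Properties.CommutativeSemigroup NP.+-commutativeSemigroup using (x∙yz≈y∙xz)
open import Algebra.Properties.Semiring.Sum NP.+-*-semiring
  using (sum; sum-syntax; sum-cong-≗; ∑-distrib-+; *-distribˡ-sum; sum-init-last)
open import Data.Bool using (Bool; true; false; T; _∧_; _∨_; if_then_else_)
import Data.Bool.Properties as BP
open import Data.Fin as F using (Fin; toℕ; _↑ˡ_; _↑ʳ_; splitAt)
import Data.Fin.Properties as FP
open import Data.Fin.Subset as Sub using (Subset; _∈_; _∉_; ⁅_⁆; _∪_; _-_; ⊤; _⊆_)
import Data.Fin.Subset.Properties as SP
open import Data.Fin.Subset.Properties using (x∈p∧x≢y⇒x∈p-y)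
open import Data.Vec using ([]; _∷_)
import Data.Vec.Base as VB
open import Data.Vec.Properties using (≡-dec)
open import Data.List as L using (List; []; _∷_; _++_; map; filter; allFin; reverse)
import Data.List.Properties as LP
open import Data.List.Relation.Unary.All as All using (All; []; _∷_)
open import Data.List.Relation.Unary.Any using (Any; here; there)
import Data.List.Relation.Unary.Any.Properties as AnyP
open import Data.List.Relation.Unary.AllPairs using (AllPairs; []; _∷_)
import Data.List.Relation.Unary.AllPairs.Properties as APP
import Data.List.Membership.Propositional.Properties as MP
open import Data.List.Membership.Propositional using () renaming (_∈_ to _∈ₗ_; _∉_ to _∉ₗ_)
import Data.List.Membership.DecPropositional as DecMem
open import Data.Maybe using (just)
open import Data.Product hiding (map)
open import Data.Sum hiding (map)
open import Data.Empty
open import Data.Unit using (tt) renaming (⊤ to Unit)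
open import Function using (_∘_; case_of_)
open import Relation.Nullary
open import Relation.Unary using (Decidable)
open import Relation.Binary.PropositionalEquality
open import Function.Bundles using (Equivalence)
open Equivalence

pattern vh = VB._[_]=_.here
pattern vt x = VB._[_]=_.there x

x∈p─q⇒x∉q : ∀ {n} (p q : Subset n) {x} → x ∈ p Sub.─ q → x ∉ q
x∈p─q⇒x∉q (true ∷ p) (false ∷ q) vh ()
x∈p─q⇒x∉q (s ∷ p) (true ∷ q) (vt h) (vt h') = x∈p─q⇒x∉q p q h h'
x∈p─q⇒x∉q (s ∷ p) (false ∷ q) (vt h) (vt h') = x∈p─q⇒x∉q p q h h'

x∈p-y⇒x≢y : ∀ {n} {p : Subset n} {x y} → x ∈ p - y → x ≢ y
x∈p-y⇒x≢y {p = p} {y = y} h refl = x∈p─q⇒x∉q p ⁅ y ⁆ h (SP.x∈⁅x⁆ y)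

x∈p-y⇒x∈p : ∀ {n} {p : Subset n} {x y} → x ∈ p - y → x ∈ p
x∈p-y⇒x∈p {p = p} {y = y} h = SP.p─q⊆p p ⁅ y ⁆ h

x∉p-x : ∀ {n} {p : Subset n} {x} → x ∉ p - x
x∉p-x h = x∈p-y⇒x≢y h refl

sumₛ : ∀ {n} → Subset n → (Fin n → ℕ) → ℕ
sumₛ [] f = 0
sumₛ (true ∷ S) f = f F.zero + sumₛ S (f ∘ F.suc)
sumₛ (false ∷ S) f = sumₛ S (f ∘ F.suc)

sumₛ-⊥ : ∀ {n} (f : Fin n → ℕ) → sumₛ Sub.⊥ f ≡ 0
sumₛ-⊥ {zero} f = refl
sumₛ-⊥ {suc n} f = sumₛ-⊥ {n} _

sumₛ-⊤ : ∀ {n} (f : Fin n → ℕ) → sumₛ ⊤ f ≡ sum f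
sumₛ-⊤ {zero} f = refl
sumₛ-⊤ {suc n} f = cong (f F.zero +_) (sumₛ-⊤ (f ∘ F.suc))

sumₛ-mono : ∀ {n} (S : Subset n) {f g : Fin n → ℕ} → (∀ v → v ∈ S → f v ≤ g v) → sumₛ S f ≤ sumₛ S g
sumₛ-mono [] h = z≤n
sumₛ-mono (true ∷ S) h = NP.+-mono-≤ (h F.zero vh) (sumₛ-mono S (λ v v∈ → h (F.suc v) (vt v∈)))
sumₛ-mono (false ∷ S) h = sumₛ-mono S (λ v v∈ → h (F.suc v) (vt v∈))

sumₛ-cong : ∀ {n} (S : Subset n) {f g : Fin n → ℕ} → (∀ v → v ∈ S → f v ≡ g v) → sumₛ S f ≡ sumₛ S g
sumₛ-cong [] h = refl
sumₛ-cong (true ∷ S) h = cong₂ _+_ (h F.zero vh) (sumₛ-cong S (λ v v∈ → h (F.suc v) (vt v∈)))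
sumₛ-cong (false ∷ S) h = sumₛ-cong S (λ v v∈ → h (F.suc v) (vt v∈))

sumₛ-0 : ∀ {n} (S : Subset n) → sumₛ S (λ _ → 0) ≡ 0
sumₛ-0 [] = refl
sumₛ-0 (true ∷ S) = sumₛ-0 S
sumₛ-0 (false ∷ S) = sumₛ-0 S

sumₛ-vanishing : ∀ {n} (S : Subset n) {f : Fin n → ℕ} → (∀ v → v ∈ S → f v ≡ 0) → sumₛ S f ≡ 0
sumₛ-vanishing S h = trans (sumₛ-cong S h) (sumₛ-0 S)

sumₛ-remove : ∀ {n} (S : Subset n) (f : Fin n → ℕ) {a} → a ∈ S → sumₛ S f ≡ f a + sumₛ (S - a) f
sumₛ-remove (true ∷ S) f {F.zero} vh = cong (λ S' → f F.zero + sumₛ S' (f ∘ F.suc)) (sym (SP.p─⊥≡p S))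
sumₛ-remove (true ∷ S) f {F.suc a} (vt a∈) =
  trans (cong (f F.zero +_) (sumₛ-remove S (f ∘ F.suc) a∈)) (x∙yz≈y∙xz (f F.zero) (f (F.suc a)) _)
sumₛ-remove (false ∷ S) f {F.suc a} (vt a∈) = sumₛ-remove S (f ∘ F.suc) a∈

filter-sorted : ∀ {n} {P : Fin n → Set} (P? : Decidable P) {R : Fin n → Fin n → Set} →
         (∀ {i k} → i F.< k → P i → P k → R i k) → AllPairs R (filter P? (allFin n))
filter-sorted {n} {P} P? {R} h = go (allFin n) (APP.tabulate⁺-< (λ lt → lt))
  where
  go : ∀ xs → AllPairs F._<_ xs → AllPairs R (filter P? xs)
  go [] [] = []
  go (x ∷ xs) (a ∷ as') with P? x
  ... | yes px = All.tabulate (λ m → let (m' , pk) = MP.∈-filter⁻ P? m in h (All.lookup a m') px pk) ∷ go xs as'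
  ... | no _ = go xs as'

AllPairs-reverse : ∀ {A : Set} {R : A → A → Set} (xs : List A) → AllPairs (λ a b → R b a) xs → AllPairs R (reverse xs)
AllPairs-reverse [] [] = []
AllPairs-reverse {R = R} (x ∷ xs) (a ∷ as') rewrite LP.unfold-reverse x xs =
  APP.++⁺ (AllPairs-reverse xs as') ([] ∷ []) (All.tabulate (λ m → All.lookup a (AnyP.reverse⁻ m) ∷ []))

All-cross : ∀ {A : Set} {R : A → A → Set} (xs ys : List A) → (∀ {a b} → a ∈ₗ xs → b ∈ₗ ys → R a b) →
        All (λ a → All (R a) ys) xs
All-cross xs ys h = All.tabulate (λ a∈ → All.tabulate (λ b∈ → h a∈ b∈))

all-any : ∀ {A : Set} {P Q : A → Set} {xs} → All P xs → Any Q xs → ∃ λ x → P x × Q x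
all-any (px ∷ _) (here qx) = _ , px , qx
all-any (_ ∷ ps) (there a) = all-any ps a

sum-mono-≤ : ∀ {n} {f g : Fin n → ℕ} → (∀ i → f i ≤ g i) → sum f ≤ sum g
sum-mono-≤ {zero} h = z≤n
sum-mono-≤ {suc n} h = NP.+-mono-≤ (h F.zero) (sum-mono-≤ (h ∘ F.suc))

sum-const : ∀ n c → ∑[ i < n ] c ≡ n * c
sum-const zero c = refl
sum-const (suc n) c = cong (c +_) (sum-const n c)

sum-↑ : ∀ m n (f : Fin (m + n) → ℕ) → sum f ≡ ∑[ i < m ] f (i ↑ˡ n) + ∑[ j < n ] f (m ↑ʳ j)
sum-↑ zero n f = refl
sum-↑ (suc m) n f = trans (cong (f F.zero +_) (sum-↑ m n (f ∘ F.suc))) (sym (NP.+-assoc (f F.zero) _ _))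

<ᵇ-true : ∀ {m n} → m < n → (m <ᵇ n) ≡ true
<ᵇ-true h = to BP.T-≡ (NP.<⇒<ᵇ h)

<ᵇ-false : ∀ {m n} → n ≤ m → (m <ᵇ n) ≡ false
<ᵇ-false {m} {n} h with m <ᵇ n in eq
... | false = refl
... | true = ⊥-elim (NP.<-irrefl refl (NP.<-≤-trans (NP.<ᵇ⇒< m n (subst T (sym eq) tt)) h))

≡ᵇ-true : ∀ {m n} → m ≡ n → (m ≡ᵇ n) ≡ true
≡ᵇ-true {m} {n} h = to BP.T-≡ (NP.≡⇒≡ᵇ m n h)

≡ᵇ-false : ∀ {m n} → m ≢ n → (m ≡ᵇ n) ≡ false
≡ᵇ-false {m} {n} h with m ≡ᵇ n in eq
... | false = refl
... | true = ⊥-elim (h (NP.≡ᵇ⇒≡ m n (subst T (sym eq) tt)))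

≤ᵇ-false : ∀ {a b} → ¬ (a ≤ b) → (a ≤ᵇ b) ≡ false
≤ᵇ-false {a} {b} a≰b with a ≤ᵇ b in eq
... | false = refl
... | true = ⊥-elim (a≰b (NP.≤ᵇ⇒≤ a b (subst T (sym eq) tt)))

𝟙 : Bool → ℕ
𝟙 b = if b then 1 else 0

𝟙-∧ˡ : ∀ a b → 𝟙 (a ∧ b) ≤ 𝟙 a
𝟙-∧ˡ true true = NP.≤-refl
𝟙-∧ˡ true false = z≤n
𝟙-∧ˡ false b = z≤n

𝟙-∧ʳ : ∀ a b → 𝟙 (a ∧ b) ≤ 𝟙 b
𝟙-∧ʳ true b = NP.≤-refl
𝟙-∧ʳ false b = z≤n

𝟙≤1 : ∀ a → 𝟙 a ≤ 1
𝟙≤1 true = NP.≤-refl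
𝟙≤1 false = z≤n

count< : ∀ n a → ∑[ k < n ] 𝟙 (toℕ k <ᵇ a) ≡ n ⊓ a
count< zero a = refl
count< (suc n) zero = trans (sum-const n 0) (NP.*-zeroʳ n)
count< (suc n) (suc a) = cong suc (count< n a)

count≥ : ∀ n a → ∑[ k < n ] 𝟙 (a ≤ᵇ toℕ k) ≡ n ∸ a
count≥ zero zero = refl
count≥ zero (suc a) = refl
count≥ (suc n) zero = cong suc (trans (sum-const n 1) (NP.*-identityʳ n))
count≥ (suc n) (suc a) = trans (sum-cong-≗ {n} {λ k → 𝟙 (suc a ≤ᵇ suc (toℕ k))} (λ k → cong 𝟙 (suc≤ᵇsuc a (toℕ k)))) (count≥ n a)
  where
  suc≤ᵇsuc : ∀ a m → (suc a ≤ᵇ suc m) ≡ (a ≤ᵇ m)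
  suc≤ᵇsuc zero m = refl
  suc≤ᵇsuc (suc a) m = refl

sum< : ∀ n → (Fin n → Fin n → ℕ) → ℕ
sum< n f = ∑[ j < n ] ∑[ k < n ] (if toℕ j <ᵇ toℕ k then f j k else 0)

sum<-cong : ∀ n {f g : Fin n → Fin n → ℕ} → (∀ j k → f j k ≡ g j k) → sum< n f ≡ sum< n g
sum<-cong n h = sum-cong-≗ (λ j → sum-cong-≗ (λ k → cong (λ x → if toℕ j <ᵇ toℕ k then x else 0) (h j k)))

sum<-+ : ∀ n f g → sum< n (λ j k → f j k + g j k) ≡ sum< n f + sum< n g
sum<-+ n f g = trans (sum-cong-≗ (λ j → trans (sum-cong-≗ (λ k → if-+ (toℕ j <ᵇ toℕ k) (f j k) (g j k))) (∑-distrib-+ (below f j) (below g j))))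
                     (∑-distrib-+ (λ j → ∑[ k < n ] below f j k) (λ j → ∑[ k < n ] below g j k))
  where
  below : (Fin n → Fin n → ℕ) → Fin n → Fin n → ℕ
  below h j k = if toℕ j <ᵇ toℕ k then h j k else 0
  if-+ : ∀ b x y → (if b then x + y else 0) ≡ (if b then x else 0) + (if b then y else 0)
  if-+ true x y = refl
  if-+ false x y = refl

pairs : ℕ → ℕ
pairs zero = 0
pairs (suc n) = n + pairs n

pairs≡C2 : ∀ n → pairs n ≡ n C 2
pairs≡C2 zero = refl
pairs≡C2 (suc n) = trans (cong₂ _+_ (sym (NC.nC1≡n n)) (pairs≡C2 n)) (NC.nCk+nC[k+1]≡[n+1]C[k+1] n 1)

sum<-1 : ∀ n → sum< n (λ _ _ → 1) ≡ pairs n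
sum<-1 zero = refl
sum<-1 (suc n) = cong₂ _+_ (trans (sum-const n 1) (NP.*-identityʳ n)) (sum<-1 n)

sum<-both : ∀ n (Z : Fin n → Bool) → sum< n (λ j k → 𝟙 (Z j ∧ Z k)) ≡ pairs (∑[ j < n ] 𝟙 (Z j))
sum<-both zero Z = refl
sum<-both (suc n) Z with Z F.zero
... | true = cong₂ _+_ (sum-cong-≗ {n} (λ k → refl)) (sum<-both n (Z ∘ F.suc))
... | false = cong₂ _+_ (trans (sum-cong-≗ {n} (λ k → refl)) (trans (sum-const n 0) (NP.*-zeroʳ n))) (sum<-both n (Z ∘ F.suc))

pairs-double : ∀ n → 2 * pairs n + n ≡ n * n
pairs-double zero = refl
pairs-double (suc n) = begin
    2 * (n + pairs n) + suc n
  ≡⟨ expand n (pairs n) ⟩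
    (2 * pairs n + n) + (2 * n + 1)
  ≡⟨ cong (_+ (2 * n + 1)) (pairs-double n) ⟩
    n * n + (2 * n + 1)
  ≡⟨ square-suc n ⟩
    suc n * suc n ∎
  where
  open ≡-Reasoning
  expand : ∀ n t → 2 * (n + t) + suc n ≡ (2 * t + n) + (2 * n + 1)
  expand = solve-∀
  square-suc : ∀ n → n * n + (2 * n + 1) ≡ suc n * suc n
  square-suc = solve-∀

pairs-+ : ∀ z m → pairs z + m * z ≤ pairs (z + m)
pairs-+ z zero rewrite NP.+-identityʳ z = NP.≤-reflexive (NP.+-identityʳ (pairs z))
pairs-+ z (suc m) rewrite NP.+-suc z m = begin
    pairs z + (z + m * z)      ≡⟨ x∙yz≈y∙xz (pairs z) z (m * z) ⟩
    z + (pairs z + m * z)      ≤⟨ NP.+-mono-≤ (NP.m≤m+n z m) (pairs-+ z m) ⟩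
    (z + m) + pairs (z + m)    ∎
  where open NP.≤-Reasoning

2*+pairs≤ : ∀ d z → 1 ≤ d → suc z ≤ 2 * d → 2 * z + pairs z ≤ 2 * d * z
2*+pairs≤ d z 1≤d z<2d = NP.*-cancelˡ-≤ 2 (NP.+-cancelʳ-≤ z _ _ (begin
    2 * (2 * z + pairs z) + z       ≡⟨ shuffle z (pairs z) ⟩
    (2 * pairs z + z) + 4 * z       ≡⟨ cong (_+ 4 * z) (pairs-double z) ⟩
    z * z + 4 * z                   ≡⟨ factor z ⟩
    z * (z + 3) + z                 ≤⟨ NP.+-monoˡ-≤ z (NP.*-monoʳ-≤ z z+3≤4d) ⟩
    z * (4 * d) + z                 ≡⟨ regroup z d ⟩
    2 * (2 * d * z) + z             ∎))
  where
  open NP.≤-Reasoning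
  shuffle : ∀ z t → 2 * (2 * z + t) + z ≡ (2 * t + z) + 4 * z
  shuffle = solve-∀
  factor : ∀ z → z * z + 4 * z ≡ z * (z + 3) + z
  factor = solve-∀
  regroup : ∀ z d → z * (4 * d) + z ≡ 2 * (2 * d * z) + z
  regroup = solve-∀
  z+3≤4d : z + 3 ≤ 4 * d
  z+3≤4d = subst₂ _≤_ (l z) (r d) (NP.+-mono-≤ z<2d (NP.*-monoʳ-≤ 2 1≤d))
    where
    l : ∀ z → suc z + 2 * 1 ≡ z + 3
    l = solve-∀
    r : ∀ d → 2 * d + 2 * d ≡ 4 * d
    r = solve-∀

-- d = p − α, z = |Z| and w = |Z ∩ {y₁, …, y_β}|; the first alternative of the minimum is
-- attained when z < 2d, the second otherwise.
min-bound : ∀ d z w q β YX YY → 1 ≤ d → z ≤ q → w ≤ z → w ≤ β →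
            2 * d * z + β ≤ YX + 2 * w → pairs q ≤ YY + pairs z →
            (pairs q + β) ⊓ (2 * q * d ∸ β) ≤ YX + YY
min-bound d z w q β YX YY 1≤d z≤q w≤z w≤β hYX hYY with suc z NP.≤? 2 * d
... | yes z<2d = NP.≤-trans (NP.m⊓n≤m _ _) (NP.+-cancelʳ-≤ (pairs z) _ _ (begin
      pairs q + β + pairs z     ≡⟨ swap₁₃ (pairs q) β (pairs z) ⟩
      (pairs z + β) + pairs q   ≤⟨ NP.+-mono-≤ YX≥ hYY ⟩
      YX + (YY + pairs z)       ≡⟨ sym (NP.+-assoc YX YY (pairs z)) ⟩
      YX + YY + pairs z         ∎))
  where
  open NP.≤-Reasoning
  swap₁₃ : ∀ a b c → a + b + c ≡ (c + b) + a
  swap₁₃ = solve-∀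
  YX≥ : pairs z + β ≤ YX
  YX≥ = NP.+-cancelʳ-≤ (2 * w) _ _ (begin
      pairs z + β + 2 * w     ≤⟨ NP.+-monoʳ-≤ (pairs z + β) (NP.*-monoʳ-≤ 2 w≤z) ⟩
      pairs z + β + 2 * z     ≡⟨ rotate (pairs z) β (2 * z) ⟩
      (2 * z + pairs z) + β   ≤⟨ NP.+-monoˡ-≤ β (2*+pairs≤ d z 1≤d z<2d) ⟩
      2 * d * z + β           ≤⟨ hYX ⟩
      YX + 2 * w              ∎)
    where
    rotate : ∀ a b c → a + b + c ≡ (c + a) + b
    rotate = solve-∀
... | no z≮2d = NP.≤-trans (NP.m⊓n≤n _ _) (NP.m≤n+o⇒m∸n≤o (2 * q * d) β (begin
      2 * q * d                         ≡⟨ split-q ⟩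
      2 * d * z + (q ∸ z) * (2 * d)     ≤⟨ NP.+-mono-≤ YX≥ YY≥ ⟩
      (YX + β) + YY                     ≡⟨ trans (NP.+-assoc YX β YY) (x∙yz≈y∙xz YX β YY) ⟩
      β + (YX + YY)                     ∎))
  where
  open NP.≤-Reasoning
  split-q : 2 * q * d ≡ 2 * d * z + (q ∸ z) * (2 * d)
  split-q = trans (cong (λ x → 2 * x * d) (sym (NP.m+[n∸m]≡n z≤q))) (distribute z (q ∸ z) d)
    where
    distribute : ∀ z m d → 2 * (z + m) * d ≡ 2 * d * z + m * (2 * d)
    distribute = solve-∀
  YX≥ : 2 * d * z ≤ YX + β
  YX≥ = NP.+-cancelʳ-≤ β _ _ (begin
      2 * d * z + β       ≤⟨ hYX ⟩
      YX + 2 * w          ≤⟨ NP.+-monoʳ-≤ YX (NP.*-monoʳ-≤ 2 w≤β) ⟩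
      YX + 2 * β          ≡⟨ double β ⟩
      YX + β + β          ∎)
    where
    double : ∀ b → YX + 2 * b ≡ YX + b + b
    double b = trans (cong (YX +_) (cong (b +_) (NP.+-identityʳ b))) (sym (NP.+-assoc YX b b))
  YY≥ : (q ∸ z) * (2 * d) ≤ YY
  YY≥ = NP.+-cancelʳ-≤ (pairs z) _ _ (begin
      (q ∸ z) * (2 * d) + pairs z     ≤⟨ NP.+-monoˡ-≤ (pairs z) (NP.*-monoʳ-≤ (q ∸ z) (s≤s⁻¹ (NP.≰⇒> z≮2d))) ⟩
      (q ∸ z) * z + pairs z           ≡⟨ NP.+-comm _ (pairs z) ⟩
      pairs z + (q ∸ z) * z           ≤⟨ pairs-+ z (q ∸ z) ⟩
      pairs (z + (q ∸ z))             ≡⟨ cong pairs (NP.m+[n∸m]≡n z≤q) ⟩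
      pairs q                         ≤⟨ hYY ⟩
      YY + pairs z                    ∎)

module _ {N : ℕ} where

  open DecMem (≡-dec {n = N} BP._≟_) using () renaming (_∈?_ to _∈ₗ?_)

  Included : List (Subset N) → List (Subset N) → Set
  Included A B = ∀ {T} → T ∈ₗ A → T ∈ₗ B

  mutual
    tubes⊆ : ∀ (t : Tree N) {T} → T ∈ₗ tubes t → T ⊆ vset t
    tubes⊆ (node r ts) (here refl) x∈ = x∈
    tubes⊆ (node r ts) (there h) x∈ = SP.x∈p∪q⁺ (inj₂ (tubesL⊆ ts h x∈))

    tubesL⊆ : ∀ (ts : List (Tree N)) {T} → T ∈ₗ tubesL ts → T ⊆ vsets ts
    tubesL⊆ (c ∷ ts) h x∈ with AnyP.++⁻ (tubes c) h
    ... | inj₁ a = SP.x∈p∪q⁺ (inj₁ (tubes⊆ c a x∈))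
    ... | inj₂ b = SP.x∈p∪q⁺ (inj₂ (tubesL⊆ ts b x∈))

  missing : List (Subset N) → List (Subset N) → ℕ
  missing xs ys = L.length (L.filter (λ A → ¬? (A ∈ₗ? ys)) xs)

  missing-pos : ∀ xs ys → 1 ≤ missing xs ys → ∃ λ a → a ∈ₗ xs × a ∉ₗ ys
  missing-pos (x ∷ xs) ys h with x ∈ₗ? ys
  ... | yes _ = let (a , a∈ , a∉) = missing-pos xs ys h in a , there a∈ , a∉
  ... | no n = x , here refl , n

  missing≥1 : ∀ xs ys {a} → a ∈ₗ xs → a ∉ₗ ys → 1 ≤ missing xs ys
  missing≥1 (x ∷ xs) ys (here refl) a∉ with x ∈ₗ? ys
  ... | yes y = ⊥-elim (a∉ y)
  ... | no _ = s≤s z≤n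
  missing≥1 (x ∷ xs) ys (there a∈) a∉ with x ∈ₗ? ys
  ... | yes _ = missing≥1 xs ys a∈ a∉
  ... | no _ = s≤s z≤n

  missing≥2 : ∀ xs ys {a b} → a ∈ₗ xs → b ∈ₗ xs → a ≢ b → a ∉ₗ ys → b ∉ₗ ys → 2 ≤ missing xs ys
  missing≥2 (x ∷ xs) ys (here refl) (here refl) ne _ _ = ⊥-elim (ne refl)
  missing≥2 (x ∷ xs) ys (here refl) (there b∈) ne a∉ b∉ with x ∈ₗ? ys
  ... | yes y = ⊥-elim (a∉ y)
  ... | no _ = s≤s (missing≥1 xs ys b∈ b∉)
  missing≥2 (x ∷ xs) ys (there a∈) (here refl) ne a∉ b∉ with x ∈ₗ? ys
  ... | yes y = ⊥-elim (b∉ y)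
  ... | no _ = s≤s (missing≥1 xs ys a∈ a∉)
  missing≥2 (x ∷ xs) ys (there a∈) (there b∈) ne a∉ b∉ with x ∈ₗ? ys
  ... | yes _ = missing≥2 xs ys a∈ b∈ ne a∉ b∉
  ... | no _ = s≤s (missing≥1 xs ys a∈ a∉)

  missing-∷ : ∀ T xs ys → (∀ {a} → a ∈ₗ xs → a ≢ T) → missing xs ys ≤ missing (T ∷ xs) (T ∷ ys)
  missing-∷ T xs ys h with ≡-dec BP._≟_ T T
  ... | no n = ⊥-elim (n refl)
  ... | yes _ = go xs h
    where
    go : ∀ xs → (∀ {a} → a ∈ₗ xs → a ≢ T) → missing xs ys ≤ missing xs (T ∷ ys)
    go [] h = z≤n
    go (x ∷ xs) h with ≡-dec BP._≟_ x T | x ∈ₗ? ys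
    ... | yes e | _ = ⊥-elim (h (here refl) e)
    ... | no _ | yes _ = go xs (λ a∈ → h (there a∈))
    ... | no _ | no _ = s≤s (go xs (λ a∈ → h (there a∈)))

  Rotated : List (Subset N) → List (Subset N) → Set
  Rotated A B = (missing A B + missing B A ≤ 2) × ((∃ λ a → a ∈ₗ A × a ∉ₗ B) ⊎ (∃ λ b → b ∈ₗ B × b ∉ₗ A))

  rotation⇒Rotated : ∀ A B → symDiffSize A B ≡ 2 → Rotated A B
  rotation⇒Rotated A B e = NP.≤-reflexive e , pos
    where
    pos : (∃ λ a → a ∈ₗ A × a ∉ₗ B) ⊎ (∃ λ b → b ∈ₗ B × b ∉ₗ A)
    pos with missing A B in eq
    ... | zero = inj₂ (missing-pos B A (NP.≤-trans (s≤s z≤n) (NP.≤-reflexive (sym e))))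
    ... | suc k = inj₁ (missing-pos A B (NP.≤-trans (s≤s z≤n) (NP.≤-reflexive (sym eq))))

  Rotated-sym : ∀ A B → Rotated A B → Rotated B A
  Rotated-sym A B (le , ex) = subst (_≤ 2) (NP.+-comm (missing A B) (missing B A)) le , Data.Sum.swap ex

  Rotated-∷⁻ : ∀ T A B → (∀ {a} → a ∈ₗ A → a ≢ T) → (∀ {b} → b ∈ₗ B → b ≢ T) → Rotated (T ∷ A) (T ∷ B) → Rotated A B
  Rotated-∷⁻ T A B hA hB (le , ex) =
    NP.≤-trans (NP.+-mono-≤ (missing-∷ T A B hA) (missing-∷ T B A hB)) le ,
    Data.Sum.map f g ex
    where
    f : (∃ λ a → a ∈ₗ (T ∷ A) × a ∉ₗ (T ∷ B)) → (∃ λ a → a ∈ₗ A × a ∉ₗ B)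
    f (a , here refl , a∉) = ⊥-elim (a∉ (here refl))
    f (a , there a∈ , a∉) = a , a∈ , (λ z → a∉ (there z))
    g : (∃ λ a → a ∈ₗ (T ∷ B) × a ∉ₗ (T ∷ A)) → (∃ λ a → a ∈ₗ B × a ∉ₗ A)
    g (a , here refl , a∉) = ⊥-elim (a∉ (here refl))
    g (a , there a∈ , a∉) = a , a∈ , (λ z → a∉ (there z))

  Rotated-¬three : ∀ A B {a1 a2 b1} → Rotated A B → a1 ∈ₗ A → a1 ∉ₗ B → a2 ∈ₗ A → a2 ∉ₗ B → a1 ≢ a2 → b1 ∈ₗ B → b1 ∉ₗ A → ⊥
  Rotated-¬three A B (le , _) a1∈ a1∉ a2∈ a2∉ ne b1∈ b1∉ =
    NP.<-irrefl refl (NP.≤-trans (NP.+-mono-≤ (missing≥2 A B a1∈ a2∈ ne a1∉ a2∉) (missing≥1 B A b1∈ b1∉)) le)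

  Rotated-unique : ∀ A B {a1 b1 a2} → Rotated A B → a1 ∈ₗ A → a1 ∉ₗ B → b1 ∈ₗ B → b1 ∉ₗ A →
             a2 ∈ₗ A → a2 ≢ a1 → a2 ∈ₗ B
  Rotated-unique A B {a2 = a2} d a1∈ a1∉ b1∈ b1∉ a2∈ a2≢a1 with a2 ∈ₗ? B
  ... | yes a2∈B = a2∈B
  ... | no a2∉B = ⊥-elim (Rotated-¬three A B d a2∈ a2∉B a1∈ a1∉ a2≢a1 b1∈ b1∉)

  Escapes : Subset N → Subset N → Set
  Escapes S T = ∃ λ w → w ∈ S × w ∉ T

module SearchTrees {N : ℕ} (Adj : Fin N → Fin N → Set) where
  V : Set
  V = Fin N

  IsST : Subset N → Tree N → Set
  IsST = IsSearchTree Adj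

  reach-∈ : ∀ {S u v} → Reach Adj S u v → v ∈ S
  reach-∈ (Reach.here u∈) = u∈
  reach-∈ (Reach.step r a v∈) = v∈

  component⊆ : ∀ {S C} → IsComponent Adj S C → C ⊆ S
  component⊆ ((u , u∈) , h) {v} v∈ = reach-∈ (to (h u v u∈) v∈)

  ∈vsets⁻ : ∀ {v : V} (ts : List (Tree N)) → v ∈ vsets ts → Any (λ c → v ∈ vset c) ts
  ∈vsets⁻ [] v∈ = ⊥-elim (SP.∉⊥ v∈)
  ∈vsets⁻ (c ∷ ts) v∈ with SP.x∈p∪q⁻ (vset c) (vsets ts) v∈
  ... | inj₁ a = here a
  ... | inj₂ b = there (∈vsets⁻ ts b)

  ∈vsets⁺ : ∀ {v : V} (ts : List (Tree N)) → Any (λ c → v ∈ vset c) ts → v ∈ vsets ts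
  ∈vsets⁺ (c ∷ ts) (here a) = SP.x∈p∪q⁺ (inj₁ a)
  ∈vsets⁺ (c ∷ ts) (there a) = SP.x∈p∪q⁺ (inj₂ (∈vsets⁺ ts a))

  root∈ : ∀ r (ts : List (Tree N)) → r ∈ vset (node r ts)
  root∈ r ts = SP.x∈p∪q⁺ (inj₁ (SP.x∈⁅x⁆ r))

  vsets⊆ : ∀ {S r ts} → IsST S (node r ts) → vsets ts ⊆ (S - r)
  vsets⊆ {ts = ts} (st r∈ allc (comp , cover , disj)) v∈ =
    let (c , cc , vc) = all-any comp (∈vsets⁻ ts v∈) in component⊆ cc vc

  vsets⊇ : ∀ {S r ts} → IsST S (node r ts) → (S - r) ⊆ vsets ts
  vsets⊇ {ts = ts} (st r∈ allc (comp , cover , disj)) v∈ = ∈vsets⁺ ts (cover _ v∈)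

  vsets-children : ∀ {S r ts} → IsST S (node r ts) → vsets ts ≡ S - r
  vsets-children h = SP.⊆-antisym (vsets⊆ h) (vsets⊇ h)

  vset-searchTree : ∀ {S t} → IsST S t → vset t ≡ S
  vset-searchTree {S} {node r ts} h@(st r∈ _ _) = SP.⊆-antisym sub sup
    where
    sub : vset (node r ts) ⊆ S
    sub {v} v∈ with SP.x∈p∪q⁻ ⁅ r ⁆ (vsets ts) v∈
    ... | inj₁ a = subst (_∈ S) (sym (SP.x∈⁅y⁆⇒x≡y r a)) r∈
    ... | inj₂ b = SP.p─q⊆p S ⁅ r ⁆ (vsets⊆ h b)
    sup : S ⊆ vset (node r ts)
    sup {v} v∈ with v FP.≟ r
    ... | yes refl = root∈ r ts
    ... | no v≢r = SP.x∈p∪q⁺ (inj₂ (vsets⊇ h (SP.x∈p∧x≢y⇒x∈p-y v∈ v≢r)))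

  root∈S : ∀ {S r ts} → IsST S (node r ts) → r ∈ S
  root∈S (st r∈ _ _) = r∈

  vset∈tubes : ∀ {S t} → IsST S t → S ∈ₗ tubes t
  vset∈tubes {S} {node r ts} h = here (sym (vset-searchTree h))

  childTube⊆ : ∀ {S r ts} → IsST S (node r ts) → ∀ {T} → T ∈ₗ tubesL ts → T ⊆ (S - r)
  childTube⊆ {ts = ts} h T∈ x∈ = vsets⊆ h (tubesL⊆ ts T∈ x∈)

  Escapes⇒∉tubes : ∀ {S r' ts'} → IsST S (node r' ts') → ∀ {T} → Escapes S T → r' ∈ T → T ∉ₗ tubes (node r' ts')
  Escapes⇒∉tubes h (w , w∈ , w∉) r'∈ (here e) = w∉ (subst (w ∈_) (sym (trans e (vset-searchTree h))) w∈)
  Escapes⇒∉tubes {ts' = ts'} h (w , w∈ , w∉) r'∈ (there m) = x∈p-y⇒x≢y (childTube⊆ h m r'∈) refl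

  ∈childTubes : ∀ {S r' ts'} → IsST S (node r' ts') → ∀ {T} → T ∈ₗ tubes (node r' ts') → Escapes S T → T ∈ₗ tubesL ts'
  ∈childTubes h (here e) (w , w∈ , w∉) = ⊥-elim (w∉ (subst (w ∈_) (sym (trans e (vset-searchTree h))) w∈))
  ∈childTubes h (there m) o = m

  ∈onlyChildTubes : ∀ {S r c} → IsST S (node r (c ∷ [])) → ∀ {T} → T ∈ₗ tubes (node r (c ∷ [])) → Escapes S T → T ∈ₗ tubes c
  ∈onlyChildTubes {c = c} h m o with AnyP.++⁻ (tubes c) (∈childTubes h m o)
  ... | inj₁ a = a
  ... | inj₂ ()

  childTube : ∀ (r : V) (c : Tree N) {T} → T ∈ₗ tubes c → T ∈ₗ tubes (node r (c ∷ []))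
  childTube r c m = there (AnyP.++⁺ˡ m)

  childTube-escapes : ∀ {S r c} → r ∈ S → IsST (S - r) c → ∀ {T} → T ∈ₗ tubes c → Escapes S T
  childTube-escapes {S} {r} {c} r∈ sc m = r , r∈ , λ r∈T → x∉p-x (subst (r ∈_) (vset-searchTree sc) (tubes⊆ c m r∈T))

  ∉tubes-of : ∀ {X d T w} → IsST X d → T ∈ₗ tubes d → w ∉ X → w ∉ T
  ∉tubes-of {X} {d} {T} {w} sd m w∉ w∈ = w∉ (subst (w ∈_) (vset-searchTree sd) (tubes⊆ d m w∈))

  Rotated-onlyChild : ∀ {S r c c'} → IsST S (node r (c ∷ [])) → IsST S (node r (c' ∷ [])) → IsST (S - r) c → IsST (S - r) c' →
            Rotated (tubes (node r (c ∷ []))) (tubes (node r (c' ∷ []))) → Rotated (tubes c) (tubes c')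
  Rotated-onlyChild {S} {r} {c} {c'} ht hu sc sc' d =
    Rotated-∷⁻ S (tubes c) (tubes c')
      (λ m e → let (w , w∈ , w∉) = childTube-escapes (root∈S ht) sc m in w∉ (subst (w ∈_) (sym e) w∈))
      (λ m e → let (w , w∈ , w∉) = childTube-escapes (root∈S ht) sc' m in w∉ (subst (w ∈_) (sym e) w∈))
      (subst₂ Rotated (cong₂ _∷_ (vset-searchTree ht) (LP.++-identityʳ (tubes c))) (cong₂ _∷_ (vset-searchTree hu) (LP.++-identityʳ (tubes c'))) d)

  leaf : V → Tree N
  leaf v = node v []

  mutual
    assoc⇒st : ∀ {ord S t} → Assoc Adj ord S t → IsST S t
    assoc⇒st (as r∈ _ allA cp) = st r∈ (assocAll allA) cp

    assocAll : ∀ {ord ts} → All (λ c → Assoc Adj ord (vset c) c) ts → All (λ c → IsST (vset c) c) ts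
    assocAll [] = []
    assocAll (a ∷ as') = assoc⇒st a ∷ assocAll as'

module SplitGraph (p q : ℕ) where

  N : ℕ
  N = p + q

  Adj : Fin N → Fin N → Set
  Adj = SPKAdj p q

  open SearchTrees Adj public

  IsX : V → Set
  IsX v = ∃ λ i → splitAt p v ≡ inj₁ i

  IsY : V → Set
  IsY v = ∃ λ j → splitAt p v ≡ inj₂ j

  HasX : Subset N → Set
  HasX S = ∃ λ v → v ∈ S × IsX v

  x⊎y : ∀ v → IsX v ⊎ IsY v
  x⊎y v with splitAt p v
  ... | inj₁ i = inj₁ (i , refl)
  ... | inj₂ j = inj₂ (j , refl)

  x≢y : ∀ {u v} → IsX u → IsY v → u ≢ v
  x≢y (i , e) (j , e') refl with trans (sym e) e'
  ... | ()

  hasX? : ∀ S → Dec (HasX S)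
  hasX? S with FP.any? (λ i → (i ↑ˡ q) SP.∈? S)
  ... | yes (i , i∈) = yes (i ↑ˡ q , i∈ , i , FP.splitAt-↑ˡ p i q)
  ... | no ¬h = no λ { (v , v∈ , i , e) → ¬h (i , subst (_∈ S) (sym (FP.splitAt⁻¹-↑ˡ e)) v∈) }

  adj-fromX : ∀ {u v} → IsX u → u ≢ v → Adj u v
  adj-fromX {u} {v} (i , e) ne with splitAt p u in e1 | splitAt p v in e2
  ... | inj₁ i' | inj₁ j = λ i'≡j → ne (trans (sym (FP.splitAt⁻¹-↑ˡ e1)) (trans (cong (_↑ˡ q) i'≡j) (FP.splitAt⁻¹-↑ˡ e2)))
  ... | inj₁ i' | inj₂ _ = tt
  ... | inj₂ _ | _ = case e of λ ()

  adj-toX : ∀ {u v} → IsX v → u ≢ v → Adj u v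
  adj-toX {u} {v} (i , e) ne with splitAt p u in e1 | splitAt p v in e2
  ... | inj₁ i' | inj₁ j = λ i'≡j → ne (trans (sym (FP.splitAt⁻¹-↑ˡ e1)) (trans (cong (_↑ˡ q) i'≡j) (FP.splitAt⁻¹-↑ˡ e2)))
  ... | inj₂ _ | inj₁ _ = tt
  ... | _ | inj₂ _ = case e of λ ()

  ¬adj-yy : ∀ {u v} → IsY u → IsY v → Adj u v → ⊥
  ¬adj-yy {u} {v} (j , e) (k , e') a with splitAt p u | splitAt p v
  ¬adj-yy (j , refl) (k , refl) () | inj₂ _ | inj₂ _

  reach-withoutX : ∀ {S u v} → ¬ HasX S → Reach Adj S u v → u ≡ v
  reach-withoutX nx (Reach.here _) = refl
  reach-withoutX {S} {u} {v} nx (Reach.step {w = w} r a v∈) with reach-withoutX nx r | x⊎y w | x⊎y v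
  ... | e | inj₁ wx | _ = ⊥-elim (nx (w , reach-∈ r , wx))
  ... | e | inj₂ _ | inj₁ vx = ⊥-elim (nx (v , v∈ , vx))
  ... | e | inj₂ wy | inj₂ vy = ⊥-elim (¬adj-yy wy vy a)

  reach-withX : ∀ {S u v} → HasX S → u ∈ S → v ∈ S → Reach Adj S u v
  reach-withX {S} {u} {v} (x , x∈ , xx) u∈ v∈ with u FP.≟ v
  ... | yes refl = Reach.here u∈
  ... | no u≢v with x⊎y u
  ... | inj₁ ux = Reach.step (Reach.here u∈) (adj-fromX ux u≢v) v∈
  ... | inj₂ uy with x FP.≟ v
  ... | yes refl = Reach.step (Reach.here u∈) (adj-toX xx (λ e → x≢y xx uy (sym e))) v∈
  ... | no x≢v = Reach.step (Reach.step (Reach.here u∈) (adj-toX xx (λ e → x≢y xx uy (sym e))) x∈) (adj-fromX xx x≢v) v∈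

  connected⇒oneChild : ∀ {S r ts} → IsST S (node r ts) → HasX (S - r) →
          ∃ λ c → ts ≡ c ∷ [] × IsST (S - r) c
  connected⇒oneChild {S} {r} {[]} h@(st r∈ allc (comp , cover , disj)) (x , x∈ , _) with cover x x∈
  ... | ()
  connected⇒oneChild {S} {r} {c ∷ []} h@(st r∈ (sc ∷ []) (comp , cover , disj)) hx =
    c , refl , subst (λ Z → IsST Z c) (SP.⊆-antisym (component⊆ (All.head comp)) λ {v} v∈ → inOnlyChild (cover v v∈)) sc
    where
    inOnlyChild : ∀ {v} → Any (λ c → v ∈ vset c) (c ∷ []) → v ∈ vset c
    inOnlyChild (here a) = a
  connected⇒oneChild {S} {r} {c1 ∷ c2 ∷ ts} h@(st r∈ allc ((cc1 ∷ cc2 ∷ _) , cover , (d ∷ _))) hx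
    with proj₁ cc1 | proj₁ cc2
  ... | (u1 , u1∈) | (u2 , u2∈) =
    ⊥-elim (All.head d (u2 , SP.x∈p∩q⁺ (from (proj₂ cc1 u1 u2 u1∈) (reach-withX hx (component⊆ cc1 u1∈) (component⊆ cc2 u2∈)) , u2∈)))

  component-leaf : ∀ {S c} → ¬ HasX S → IsComponent Adj S (vset c) → IsST (vset c) c → ∃ λ v → c ≡ leaf v × v ∈ S
  component-leaf {S} {node v []} nx cc sc = v , refl , component⊆ cc (root∈ v [])
  component-leaf {S} {node v (c'' ∷ ts')} nx cc (st _ _ ((cc'' ∷ _) , _ , _)) =
    ⊥-elim (x∈p-y⇒x≢y w∈' (sym (reach-withoutX nx (to (proj₂ cc v w (root∈ v (c'' ∷ ts'))) w∈c))))
    where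
    w = proj₁ (proj₁ cc'')
    w∈' : w ∈ (vset (node v (c'' ∷ ts')) - v)
    w∈' = component⊆ cc'' (proj₂ (proj₁ cc''))
    w∈c : w ∈ vset (node v (c'' ∷ ts'))
    w∈c = x∈p-y⇒x∈p w∈'

  disconnected⇒leafChildren : ∀ {S r ts} → IsST S (node r ts) → ¬ HasX (S - r) →
          ∃ λ vs → ts ≡ map leaf vs × All (_∈ (S - r)) vs
  disconnected⇒leafChildren {S} {r} {ts} (st r∈ allc (comp , cover , disj)) nx = go ts allc comp
    where
    go : ∀ ts → All (λ c → IsST (vset c) c) ts → All (λ c → IsComponent Adj (S - r) (vset c)) ts →
         ∃ λ vs → ts ≡ map leaf vs × All (_∈ (S - r)) vs
    go [] _ _ = [] , refl , []
    go (c ∷ ts) (sc ∷ scs) (cc ∷ ccs) with component-leaf nx cc sc | go ts scs ccs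
    ... | v , refl , v∈ | vs , refl , a = v ∷ vs , refl , v∈ ∷ a

  vsets-leaves⁻ : ∀ (vs : List V) {v} → v ∈ vsets (map leaf vs) → v ∈ₗ vs
  vsets-leaves⁻ [] h = ⊥-elim (SP.∉⊥ h)
  vsets-leaves⁻ (w ∷ vs) h with SP.x∈p∪q⁻ (vset (leaf w)) (vsets (map leaf vs)) h
  ... | inj₂ v∈vs = there (vsets-leaves⁻ vs v∈vs)
  ... | inj₁ v∈w with SP.x∈p∪q⁻ ⁅ w ⁆ Sub.⊥ v∈w
  ...   | inj₁ v∈⁅w⁆ = here (SP.x∈⁅y⁆⇒x≡y w v∈⁅w⁆)
  ...   | inj₂ v∈⊥ = ⊥-elim (SP.∉⊥ v∈⊥)

  disconnected⇒leaves : ∀ {S r ts} → IsST S (node r ts) → ¬ HasX (S - r) →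
           ∃ λ vs → ts ≡ map leaf vs × (∀ v → v ∈ₗ vs → v ∈ (S - r)) × (∀ v → v ∈ (S - r) → v ∈ₗ vs)
  disconnected⇒leaves {S} {r} {ts} h nx with disconnected⇒leafChildren h nx
  ... | vs , refl , a = vs , refl , (λ v v∈ → All.lookup a v∈) , (λ v v∈ → vsets-leaves⁻ vs (subst (v ∈_) (sym (vsets-children h)) v∈))

  tubes-leaves⁻ : ∀ (vs : List V) {T} → T ∈ₗ tubesL (map leaf vs) → ∃ λ v → v ∈ₗ vs × T ≡ ⁅ v ⁆ ∪ Sub.⊥
  tubes-leaves⁻ (v ∷ vs) (here e) = v , here refl , e
  tubes-leaves⁻ (v ∷ vs) (there h) = let (w , w∈ , e) = tubes-leaves⁻ vs h in w , there w∈ , e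

  tubes-leaves⁺ : ∀ (vs : List V) {v} → v ∈ₗ vs → (⁅ v ⁆ ∪ Sub.⊥) ∈ₗ tubesL (map leaf vs)
  tubes-leaves⁺ (v ∷ vs) (here refl) = here refl
  tubes-leaves⁺ (w ∷ vs) (there h) = there (tubes-leaves⁺ vs h)

  remainderWithoutX⇒rootX : ∀ {S r} → HasX S → ¬ HasX (S - r) → IsX r
  remainderWithoutX⇒rootX {S} {r} (x , x∈ , xx) nx with x FP.≟ r
  ... | yes refl = xx
  ... | no ne = ⊥-elim (nx (x , x∈p∧x≢y⇒x∈p-y x∈ ne , xx))

  remainderWithoutX⇒Y : ∀ {S r v} → ¬ HasX (S - r) → v ∈ S → v ≢ r → IsY v
  remainderWithoutX⇒Y {v = v} nx v∈ ne with x⊎y v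
  ... | inj₁ vx = ⊥-elim (nx (v , x∈p∧x≢y⇒x∈p-y v∈ ne , vx))
  ... | inj₂ vy = vy

  differentRoots⇒distinguishingTube : ∀ {S r r' ts ts'} → HasX S → IsST S (node r ts) → IsST S (node r' ts') → r ≢ r' →
    (∃ λ T → T ∈ₗ tubes (node r ts) × T ∉ₗ tubes (node r' ts')) ⊎ (∃ λ T → T ∈ₗ tubes (node r' ts') × T ∉ₗ tubes (node r ts))
  differentRoots⇒distinguishingTube {S} {r} {r'} hx ht hu ne with hasX? (S - r) | hasX? (S - r')
  ... | yes hxr | _ with connected⇒oneChild ht hxr
  ...   | c , refl , sc = inj₁ (S - r , childTube _ _ (vset∈tubes sc) , Escapes⇒∉tubes hu (r , root∈S ht , x∉p-x) (x∈p∧x≢y⇒x∈p-y (root∈S hu) (≢-sym ne)))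
  differentRoots⇒distinguishingTube {S} {r} {r'} hx ht hu ne | no _ | yes hxr' with connected⇒oneChild hu hxr'
  ...   | c , refl , sc = inj₂ (S - r' , childTube _ _ (vset∈tubes sc) , Escapes⇒∉tubes ht (r' , root∈S hu , x∉p-x) (x∈p∧x≢y⇒x∈p-y (root∈S ht) ne))
  differentRoots⇒distinguishingTube {S} {r} {r'} hx ht hu ne | no nxr | no nxr' =
    ⊥-elim (nxr (r' , x∈p∧x≢y⇒x∈p-y (root∈S hu) (≢-sym ne) , remainderWithoutX⇒rootX hx nxr'))

  leafTube-withoutX : ∀ (vs : List V) {T} → T ∈ₗ tubesL (map leaf vs) → (∀ v → v ∈ₗ vs → IsY v) → HasX T → ⊥
  leafTube-withoutX vs m hy (x , x∈ , xx) with tubes-leaves⁻ vs m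
  ... | v , v∈ , refl with SP.x∈p∪q⁻ ⁅ v ⁆ Sub.⊥ x∈
  ...   | inj₂ b = SP.∉⊥ b
  ...   | inj₁ b with SP.x∈⁅y⁆⇒x≡y v b
  ...     | refl = x≢y xx (hy v v∈) refl

  ∉singleton : ∀ {w r' : V} → w ≢ r' → w ∉ (⁅ r' ⁆ ∪ Sub.⊥)
  ∉singleton {r' = r'} ne' h with SP.x∈p∪q⁻ ⁅ r' ⁆ Sub.⊥ h
  ... | inj₁ b = ne' (SP.x∈⁅y⁆⇒x≡y r' b)
  ... | inj₂ b = SP.∉⊥ b

  ∈singleton : ∀ (r' : V) → r' ∈ (⁅ r' ⁆ ∪ Sub.⊥)
  ∈singleton r' = SP.x∈p∪q⁺ (inj₁ (SP.x∈⁅x⁆ r'))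

  rotation-connectedGrandchild : ∀ {S r r' r2 ts2 ts'} → IsST S (node r (node r2 ts2 ∷ [])) → IsST S (node r' ts') → r ≢ r' →
         IsST (S - r) (node r2 ts2) → HasX ((S - r) - r2) →
         Rotated (tubes (node r (node r2 ts2 ∷ []))) (tubes (node r' ts')) →
         ∀ {b1} → b1 ∈ₗ tubes (node r' ts') → b1 ∉ₗ tubes (node r (node r2 ts2 ∷ [])) →
         r2 ≡ r' × ((S - r) - r2) ∈ₗ tubes (node r' ts')
  rotation-connectedGrandchild {S} {r} {r'} {r2} {ts2} {ts'} ht hu ne sc hx2 d b1∈ b1∉ with connected⇒oneChild sc hx2
  ... | dd , refl , sd = r2≡r' , a2∈u
    where
    a1∈ : (S - r) ∈ₗ tubes (node r (node r2 ts2 ∷ []))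
    a1∈ = childTube r (node r2 ts2) (vset∈tubes sc)
    a1∉ : (S - r) ∉ₗ tubes (node r' ts')
    a1∉ = Escapes⇒∉tubes hu (r , root∈S ht , x∉p-x) (x∈p∧x≢y⇒x∈p-y (root∈S hu) (≢-sym ne))
    a2∈ : ((S - r) - r2) ∈ₗ tubes (node r (node r2 ts2 ∷ []))
    a2∈ = childTube r (node r2 (dd ∷ [])) (childTube r2 dd (vset∈tubes sd))
    a2≢a1 : ((S - r) - r2) ≢ (S - r)
    a2≢a1 e = x∉p-x (subst (r2 ∈_) (sym e) (root∈S sc))
    a2∈u : ((S - r) - r2) ∈ₗ tubes (node r' ts')
    a2∈u = Rotated-unique _ _ d a1∈ a1∉ b1∈ b1∉ a2∈ a2≢a1
    sub : ((S - r) - r2) ⊆ (S - r')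
    sub = childTube⊆ hu (∈childTubes hu a2∈u (r , root∈S ht , x∉p-x ∘ x∈p-y⇒x∈p))
    r2≡r' : r2 ≡ r'
    r2≡r' with r2 FP.≟ r'
    ... | yes e = e
    ... | no n = ⊥-elim (x∉p-x (sub (x∈p∧x≢y⇒x∈p-y (x∈p∧x≢y⇒x∈p-y (root∈S hu) (≢-sym ne)) (≢-sym n))))

  rotation-leafGrandchildren : ∀ {S r r' r2 vs ts'} → IsST S (node r (node r2 (map leaf vs) ∷ [])) → IsST S (node r' ts') → r ≢ r' →
         IsST (S - r) (node r2 (map leaf vs)) → (∀ v → v ∈ ((S - r) - r2) → v ∈ₗ vs) →
         Rotated (tubes (node r (node r2 (map leaf vs) ∷ []))) (tubes (node r' ts')) →
         ∀ {b1} → b1 ∈ₗ tubes (node r' ts') → b1 ∉ₗ tubes (node r (node r2 (map leaf vs) ∷ [])) →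
         r2 ≡ r'
  rotation-leafGrandchildren {S} {r} {r'} {r2} {vs} {ts'} ht hu ne sc cov d {b1} b1∈ b1∉ with r2 FP.≟ r'
  ... | yes e = e
  ... | no n = ⊥-elim (Rotated-¬three _ _ d a1∈ a1∉ t'∈ t'∉ a1≢t' b1∈ b1∉)
    where
    a1∈ : (S - r) ∈ₗ tubes (node r (node r2 (map leaf vs) ∷ []))
    a1∈ = childTube r (node r2 (map leaf vs)) (vset∈tubes sc)
    a1∉ : (S - r) ∉ₗ tubes (node r' ts')
    a1∉ = Escapes⇒∉tubes hu (r , root∈S ht , x∉p-x) (x∈p∧x≢y⇒x∈p-y (root∈S hu) (≢-sym ne))
    r'∈ : r' ∈ ((S - r) - r2)
    r'∈ = x∈p∧x≢y⇒x∈p-y (x∈p∧x≢y⇒x∈p-y (root∈S hu) (≢-sym ne)) (≢-sym n)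
    t'∈ : (⁅ r' ⁆ ∪ Sub.⊥) ∈ₗ tubes (node r (node r2 (map leaf vs) ∷ []))
    t'∈ = childTube r (node r2 (map leaf vs)) (there (tubes-leaves⁺ vs (cov r' r'∈)))
    t'∉ : (⁅ r' ⁆ ∪ Sub.⊥) ∉ₗ tubes (node r' ts')
    t'∉ = Escapes⇒∉tubes hu (r , root∈S ht , ∉singleton ne) (∈singleton r')
    a1≢t' : (S - r) ≢ (⁅ r' ⁆ ∪ Sub.⊥)
    a1≢t' e = ∉singleton n (subst (r2 ∈_) e (root∈S sc))

  rotation-againstLeaves : ∀ {S r r' r2 ts2 vs'} → HasX S → IsST S (node r (node r2 ts2 ∷ [])) → IsST S (node r' (map leaf vs')) → r ≢ r' →
         IsST (S - r) (node r2 ts2) → ¬ HasX (S - r') → (∀ v → v ∈ (S - r') → v ∈ₗ vs') → (∀ v → v ∈ₗ vs' → v ∈ (S - r')) →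
         Rotated (tubes (node r (node r2 ts2 ∷ []))) (tubes (node r' (map leaf vs'))) →
         r2 ≡ r' × ¬ HasX ((S - r) - r2)
  rotation-againstLeaves {S} {r} {r'} {r2} {ts2} {vs'} hx ht hu ne sc nx' cov' sub' d = r2≡r' , nx2
    where
    r∈ : r ∈ (S - r')
    r∈ = x∈p∧x≢y⇒x∈p-y (root∈S ht) ne
    b1∈ : (⁅ r ⁆ ∪ Sub.⊥) ∈ₗ tubes (node r' (map leaf vs'))
    b1∈ = there (tubes-leaves⁺ vs' (cov' r r∈))
    b1∉ : (⁅ r ⁆ ∪ Sub.⊥) ∉ₗ tubes (node r (node r2 ts2 ∷ []))
    b1∉ = Escapes⇒∉tubes ht (r' , root∈S hu , ∉singleton (≢-sym ne)) (∈singleton r)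
    nx2 : ¬ HasX ((S - r) - r2)
    nx2 hx2 with rotation-connectedGrandchild ht hu ne sc hx2 d b1∈ b1∉
    ... | e , a2∈ = leafTube-withoutX vs' (∈childTubes hu a2∈ (r , root∈S ht , x∉p-x ∘ x∈p-y⇒x∈p))
                      (λ v v∈ → remainderWithoutX⇒Y nx' (x∈p-y⇒x∈p (sub' v v∈)) (x∈p-y⇒x≢y (sub' v v∈))) hx2
    r'x : IsX r'
    r'x = remainderWithoutX⇒rootX hx nx'
    r2≡r' : r2 ≡ r'
    r2≡r' with r2 FP.≟ r'
    ... | yes e = e
    ... | no n = ⊥-elim (nx2 (r' , x∈p∧x≢y⇒x∈p-y (x∈p∧x≢y⇒x∈p-y (root∈S hu) (≢-sym ne)) (≢-sym n) , r'x))

  leafTubes-included : ∀ {S r vs vs'} → (∀ v → v ∈ₗ vs → v ∈ (S - r)) → (∀ v → v ∈ (S - r) → v ∈ₗ vs') →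
    IsST S (node r (map leaf vs)) → IsST S (node r (map leaf vs')) → Included (tubes (node r (map leaf vs))) (tubes (node r (map leaf vs')))
  leafTubes-included sA cB hA hB (here e) = here (trans e (trans (vset-searchTree hA) (sym (vset-searchTree hB))))
  leafTubes-included {vs = vs} {vs' = vs'} sA cB hA hB (there m) with tubes-leaves⁻ vs m
  ... | v , v∈ , e = there (subst (λ T → T ∈ₗ tubesL (map leaf vs')) (sym e) (tubes-leaves⁺ vs' (cB v (sA v v∈))))

module Potential (p q β : ℕ) where
  open SplitGraph p q public

  Marks : Set
  Marks = Fin q → Bool

  xyCost : Fin p → Fin q → ℕ
  xyCost i j = if (suc (toℕ i) ≡ᵇ p) ∧ (toℕ j <ᵇ β) then 0 else 1

  cost' : Marks → Fin p ⊎ Fin q → Fin p ⊎ Fin q → ℕ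
  cost' Z (inj₁ i) (inj₁ j) = 𝟙 (toℕ i <ᵇ toℕ j)
  cost' Z (inj₁ i) (inj₂ j) = xyCost i j
  cost' Z (inj₂ j) (inj₁ i) = if Z j then suc (xyCost i j) else 1 ∸ xyCost i j
  cost' Z (inj₂ j) (inj₂ k) = if Z j ∧ Z k then 0 else 𝟙 (toℕ j <ᵇ toℕ k)

  cost : Marks → V → V → ℕ
  cost Z u v = cost' Z (splitAt p u) (splitAt p v)

  mutual
    Φ : Marks → Tree N → ℕ
    Φ Z (node r ts) = sumₛ (vsets ts) (cost Z r) + Φs Z ts

    Φs : Marks → List (Tree N) → ℕ
    Φs Z [] = 0
    Φs Z (t ∷ ts) = Φ Z t + Φs Z ts

  Marked' : Marks → Fin p ⊎ Fin q → Set
  Marked' Z (inj₁ _) = Unit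
  Marked' Z (inj₂ j) = T (Z j)

  Marked : Marks → V → Set
  Marked Z v = Marked' Z (splitAt p v)

  mutual
    LeavesMarked : Marks → Tree N → Set
    LeavesMarked Z (node r []) = Marked Z r
    LeavesMarked Z (node r (t ∷ ts)) = LeavesMarkedₗ Z (t ∷ ts)

    LeavesMarkedₗ : Marks → List (Tree N) → Set
    LeavesMarkedₗ Z [] = Unit
    LeavesMarkedₗ Z (t ∷ ts) = LeavesMarked Z t × LeavesMarkedₗ Z ts

  mark : Marks → Fin q → Marks
  mark Z j k = Z k ∨ does (k FP.≟ j)

  xyCost≤1 : ∀ i j → xyCost i j ≤ 1
  xyCost≤1 i j with (suc (toℕ i) ≡ᵇ p) ∧ (toℕ j <ᵇ β)
  ... | true = z≤n
  ... | false = s≤s z≤n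

  cost'-flip : ∀ Z a b → cost' Z a b ≤ suc (cost' Z b a)
  cost'-flip Z (inj₁ i) (inj₁ j) = NP.≤-trans (𝟙≤1 (toℕ i <ᵇ toℕ j)) (s≤s z≤n)
  cost'-flip Z (inj₁ i) (inj₂ j) = NP.≤-trans (xyCost≤1 i j) (s≤s z≤n)
  cost'-flip Z (inj₂ j) (inj₁ i) with Z j
  ... | true = NP.≤-refl
  ... | false = NP.≤-trans (NP.m∸n≤m 1 (xyCost i j)) (s≤s z≤n)
  cost'-flip Z (inj₂ j) (inj₂ k) with Z j ∧ Z k
  ... | true = z≤n
  ... | false = NP.≤-trans (𝟙≤1 (toℕ j <ᵇ toℕ k)) (s≤s z≤n)

  cost-flip : ∀ Z a b → cost Z a b ≤ suc (cost Z b a)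
  cost-flip Z a b = cost'-flip Z (splitAt p a) (splitAt p b)

  cost'-mark : ∀ Z j a b → a ≢ inj₂ j → cost' (mark Z j) a b ≤ cost' Z a b
  cost'-mark Z j (inj₁ i) (inj₁ k) ne = NP.≤-refl
  cost'-mark Z j (inj₁ i) (inj₂ k) ne = NP.≤-refl
  cost'-mark Z j (inj₂ k) (inj₁ i) ne with k FP.≟ j
  ... | yes refl = ⊥-elim (ne refl)
  ... | no _ rewrite BP.∨-identityʳ (Z k) = NP.≤-refl
  cost'-mark Z j (inj₂ k) (inj₂ l) ne with k FP.≟ j
  ... | yes refl = ⊥-elim (ne refl)
  ... | no _ rewrite BP.∨-identityʳ (Z k) with Z k | Z l | l FP.≟ j
  ...   | false | _ | _ = NP.≤-refl
  ...   | true | true | _ = NP.≤-refl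
  ...   | true | false | yes _ = z≤n
  ...   | true | false | no _ = NP.≤-refl

  cost-mark : ∀ Z j w v → w ≢ yv p q j → cost (mark Z j) w v ≤ cost Z w v
  cost-mark Z j w v ne = cost'-mark Z j (splitAt p w) (splitAt p v) λ e → ne (sym (FP.splitAt⁻¹-↑ʳ e))

  Marked-mark : ∀ Z j v → Marked Z v → Marked (mark Z j) v
  Marked-mark Z j v h with splitAt p v
  ... | inj₁ _ = tt
  ... | inj₂ k with Z k
  ...   | true = tt

  Marked-mark-self : ∀ Z j → Marked (mark Z j) (yv p q j)
  Marked-mark-self Z j rewrite FP.splitAt-↑ʳ p q j with j FP.≟ j
  ... | yes _ rewrite BP.∨-zeroʳ (Z j) = tt
  ... | no n = ⊥-elim (n refl)

  Marked-x : ∀ Z v → IsX v → Marked Z v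
  Marked-x Z v (i , e) rewrite e = tt

  cost-yy : ∀ Z a b → IsY a → IsY b → Marked Z a → Marked Z b → cost Z a b ≡ 0
  cost-yy Z a b (j , ea) (k , eb) ya yb with splitAt p a | splitAt p b
  cost-yy Z a b (j , refl) (k , refl) ya yb | inj₂ _ | inj₂ _ with Z j | Z k
  ... | true | true = refl

  cost-yx : ∀ Z a b → IsY a → IsX b → Marked Z a → cost Z a b ≡ suc (cost Z b a)
  cost-yx Z a b (j , ea) (i , eb) ya with splitAt p a | splitAt p b
  cost-yx Z a b (j , refl) (i , refl) ya | inj₂ _ | inj₁ _ with Z j
  ... | true = refl

  cost-fromX : ∀ Z Z' a v → IsX a → cost Z a v ≡ cost Z' a v
  cost-fromX Z Z' a v (i , ea) with splitAt p a | splitAt p v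
  cost-fromX Z Z' a v (i , refl) | inj₁ _ | inj₁ _ = refl
  cost-fromX Z Z' a v (i , refl) | inj₁ _ | inj₂ _ = refl

  Φs-leaves : ∀ Z (vs : List V) → Φs Z (map leaf vs) ≡ 0
  Φs-leaves Z [] = refl
  Φs-leaves Z (v ∷ vs) rewrite sumₛ-⊥ (cost Z v) = Φs-leaves Z vs

  LeavesMarked-node : ∀ Z r (vs : List V) → Marked Z r → (∀ v → v ∈ₗ vs → Marked Z v) → LeavesMarked Z (node r (map leaf vs))
  LeavesMarked-node Z r [] yr h = yr
  LeavesMarked-node Z r (v ∷ vs) yr h = go (v ∷ vs) h
    where
    go : ∀ (ws : List V) → (∀ v → v ∈ₗ ws → Marked Z v) → LeavesMarkedₗ Z (map leaf ws)
    go [] h = tt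
    go (w ∷ ws) h = h w (here refl) , go ws (λ v v∈ → h v (there v∈))

  LeavesMarked-node⁻ : ∀ Z r (vs : List V) → LeavesMarked Z (node r (map leaf vs)) → ∀ v → v ∈ₗ vs → Marked Z v
  LeavesMarked-node⁻ Z r [] h v ()
  LeavesMarked-node⁻ Z r (w ∷ vs) h = go (w ∷ vs) h
    where
    go : ∀ (ws : List V) → LeavesMarkedₗ Z (map leaf ws) → ∀ v → v ∈ₗ ws → Marked Z v
    go (w ∷ ws) (a , b) v (here refl) = a
    go (w ∷ ws) (a , b) v (there h) = go ws b v h

  sameTubes⇒sameΦ : ∀ S t u → HasX S → IsST S t → IsST S u → Included (tubes t) (tubes u) → Included (tubes u) (tubes t)
         → ∀ Z → Φ Z t ≡ Φ Z u × (LeavesMarked Z u → LeavesMarked Z t)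
  sameTubes⇒sameΦ S (node r ts) (node r' ts') hx ht hu i1 i2 Z with r FP.≟ r'
  ... | no ne = ⊥-elim (Data.Sum.[_,_] (λ { (T , a , b) → b (i1 a) }) (λ { (T , a , b) → b (i2 a) }) (differentRoots⇒distinguishingTube hx ht hu ne))
  ... | yes refl with hasX? (S - r)
  ...   | yes hxr with connected⇒oneChild ht hxr | connected⇒oneChild hu hxr
  ...     | c , refl , sc | c' , refl , sc' =
    cong₂ _+_ (cong (λ X → sumₛ X (cost Z r)) (trans (vsets-children ht) (sym (vsets-children hu)))) (cong (_+ 0) (proj₁ rec)) ,
    (λ { (a , b) → proj₂ rec a , b })
    where
    rec = sameTubes⇒sameΦ (S - r) c c' hxr sc sc'
      (λ m → ∈onlyChildTubes hu (i1 (childTube _ _ m)) (childTube-escapes (root∈S ht) sc m))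
      (λ m → ∈onlyChildTubes ht (i2 (childTube _ _ m)) (childTube-escapes (root∈S ht) sc' m)) Z
  sameTubes⇒sameΦ S (node r ts) (node r' ts') hx ht hu i1 i2 Z | yes refl | no nxr with disconnected⇒leaves ht nxr | disconnected⇒leaves hu nxr
  ... | vs , refl , s1 , c1 | vs' , refl , s2 , c2 =
    cong₂ _+_ (cong (λ X → sumₛ X (cost Z r)) (trans (vsets-children ht) (sym (vsets-children hu)))) (trans (Φs-leaves Z vs) (sym (Φs-leaves Z vs'))) ,
    λ h → LeavesMarked-node Z r vs (Marked-x Z r (remainderWithoutX⇒rootX hx nxr)) (λ v v∈ → LeavesMarked-node⁻ Z r vs' h v (c2 v (s1 v v∈)))

  Φ-chain : ∀ Z {S r r' ts} → r' ∈ S - r → vsets (node r' ts ∷ []) ≡ S - r → vsets ts ≡ S - r - r' →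
            Φ Z (node r (node r' ts ∷ [])) ≡ cost Z r r' + (sumₛ (S - r - r') (cost Z r) + (sumₛ (S - r - r') (cost Z r') + Φs Z ts))
  Φ-chain Z {S} {r} {r'} {ts} r'∈ below-r below-r' = begin
      sumₛ (vsets (node r' ts ∷ [])) (cost Z r) + ((sumₛ (vsets ts) (cost Z r') + Φs Z ts) + 0)
    ≡⟨ cong₂ (λ P Q → sumₛ P (cost Z r) + ((sumₛ Q (cost Z r') + Φs Z ts) + 0)) below-r below-r' ⟩
      sumₛ (S - r) (cost Z r) + ((sumₛ (S - r - r') (cost Z r') + Φs Z ts) + 0)
    ≡⟨ cong₂ _+_ (sumₛ-remove (S - r) (cost Z r) r'∈) (NP.+-identityʳ _) ⟩
      (cost Z r r' + sumₛ (S - r - r') (cost Z r)) + (sumₛ (S - r - r') (cost Z r') + Φs Z ts)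
    ≡⟨ NP.+-assoc (cost Z r r') _ _ ⟩
      cost Z r r' + (sumₛ (S - r - r') (cost Z r) + (sumₛ (S - r - r') (cost Z r') + Φs Z ts)) ∎
    where open ≡-Reasoning

  Φ-star : ∀ Z {S r' r vs} → r ∈ S - r' → vsets (map leaf vs) ≡ S - r' →
           Φ Z (node r' (map leaf vs)) ≡ cost Z r' r + sumₛ (S - r - r') (cost Z r')
  Φ-star Z {S} {r'} {r} {vs} r∈ leaves≡ = begin
      sumₛ (vsets (map leaf vs)) (cost Z r') + Φs Z (map leaf vs)
    ≡⟨ cong₂ (λ P Q → sumₛ P (cost Z r') + Q) leaves≡ (Φs-leaves Z vs) ⟩
      sumₛ (S - r') (cost Z r') + 0
    ≡⟨ trans (NP.+-identityʳ _) (sumₛ-remove (S - r') (cost Z r') r∈) ⟩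
      cost Z r' r + sumₛ (S - r' - r) (cost Z r')
    ≡⟨ cong (λ W → cost Z r' r + sumₛ W (cost Z r')) (SP.p─x─y≡p─y─x S r' r) ⟩
      cost Z r' r + sumₛ (S - r - r') (cost Z r') ∎
    where open ≡-Reasoning

  Φ-swap : ∀ Z {S r r' ts₁ ts₂} → r' ∈ S - r → r ∈ S - r' →
    vsets (node r' ts₁ ∷ []) ≡ S - r → vsets (node r ts₂ ∷ []) ≡ S - r' →
    vsets ts₁ ≡ S - r - r' → vsets ts₂ ≡ S - r' - r → Φs Z ts₁ ≡ Φs Z ts₂ →
    Φ Z (node r (node r' ts₁ ∷ [])) ≤ suc (Φ Z (node r' (node r ts₂ ∷ [])))
  Φ-swap Z {S} {r} {r'} {ts₁} {ts₂} r'∈ r∈ below-r below-r' below-rr' below-r'r same = begin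
      Φ Z (node r (node r' ts₁ ∷ []))
    ≡⟨ Φ-chain Z {ts = ts₁} r'∈ below-r below-rr' ⟩
      cost Z r r' + (X + (B + Φs Z ts₁))
    ≤⟨ NP.+-monoˡ-≤ _ (cost-flip Z r r') ⟩
      suc (cost Z r' r + (X + (B + Φs Z ts₁)))
    ≡⟨ cong (λ k → suc (cost Z r' r + k)) (trans (x∙yz≈y∙xz X B _) (cong (λ l → B + (X + l)) same)) ⟩
      suc (cost Z r' r + (B + (X + Φs Z ts₂)))
    ≡⟨ cong suc (sym (trans (Φ-chain Z {ts = ts₂} r∈ below-r' below-r'r) (cong (λ W → cost Z r' r + (sumₛ W (cost Z r') + (sumₛ W (cost Z r) + Φs Z ts₂))) W≡))) ⟩
      suc (Φ Z (node r' (node r ts₂ ∷ []))) ∎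
    where
    open NP.≤-Reasoning
    X = sumₛ (S - r - r') (cost Z r)
    B = sumₛ (S - r - r') (cost Z r')
    W≡ : S - r' - r ≡ S - r - r'
    W≡ = SP.p─x─y≡p─y─x S r' r

  Φ-dropY : ∀ Z {S r r' vs vs'} → r' ∈ S - r → r ∈ S - r' →
    vsets (node r' (map leaf vs) ∷ []) ≡ S - r → vsets (map leaf vs) ≡ S - r - r' → vsets (map leaf vs') ≡ S - r' →
    cost Z r r' ≡ suc (cost Z r' r) → sumₛ (S - r - r') (cost Z r) ≡ 0 →
    Φ Z (node r (node r' (map leaf vs) ∷ [])) ≡ suc (Φ Z (node r' (map leaf vs')))
  Φ-dropY Z {S} {r} {r'} {vs} {vs'} r'∈ r∈ below-r below-rr' leaves≡ flip≡ r-costs≡0 = begin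
      Φ Z (node r (node r' (map leaf vs) ∷ []))
    ≡⟨ Φ-chain Z {ts = map leaf vs} r'∈ below-r below-rr' ⟩
      cost Z r r' + (sumₛ (S - r - r') (cost Z r) + (B + Φs Z (map leaf vs)))
    ≡⟨ cong₂ (λ c x → c + (x + (B + Φs Z (map leaf vs)))) flip≡ r-costs≡0 ⟩
      suc (cost Z r' r + (B + Φs Z (map leaf vs)))
    ≡⟨ cong (λ l → suc (cost Z r' r + l)) (trans (cong (B +_) (Φs-leaves Z vs)) (NP.+-identityʳ B)) ⟩
      suc (cost Z r' r + B)
    ≡⟨ cong suc (sym (Φ-star Z {vs = vs'} r∈ leaves≡)) ⟩
      suc (Φ Z (node r' (map leaf vs'))) ∎
    where
    open ≡-Reasoning
    B = sumₛ (S - r - r') (cost Z r')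

  Φ-liftY : ∀ Z Z' {S r r' vs vs'} → IsX r → r' ∈ S - r → r ∈ S - r' →
    vsets (map leaf vs) ≡ S - r → vsets (node r (map leaf vs') ∷ []) ≡ S - r' → vsets (map leaf vs') ≡ S - r' - r →
    Φ Z' (node r (map leaf vs)) ≤ suc (Φ Z (node r' (node r (map leaf vs') ∷ [])))
  Φ-liftY Z Z' {S} {r} {r'} {vs} {vs'} r-x r'∈ r∈ leaves≡ below-r' below-r'r = begin
      Φ Z' (node r (map leaf vs))
    ≡⟨ Φ-star Z' {vs = vs} r'∈ leaves≡ ⟩
      cost Z' r r' + sumₛ (S - r' - r) (cost Z' r)
    ≡⟨ cong₂ _+_ (cost-fromX Z' Z r r' r-x) (sumₛ-cong (S - r' - r) (λ v _ → cost-fromX Z' Z r v r-x)) ⟩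
      cost Z r r' + X
    ≤⟨ NP.+-monoˡ-≤ X (cost-flip Z r r') ⟩
      suc (cost Z r' r + X)
    ≤⟨ s≤s (NP.+-monoʳ-≤ (cost Z r' r) (NP.m≤n+m X _)) ⟩
      suc (cost Z r' r + (sumₛ (S - r' - r) (cost Z r') + X))
    ≡⟨ cong (λ l → suc (cost Z r' r + (sumₛ (S - r' - r) (cost Z r') + l))) (sym (trans (cong (X +_) (Φs-leaves Z vs')) (NP.+-identityʳ X))) ⟩
      suc (cost Z r' r + (sumₛ (S - r' - r) (cost Z r') + (X + Φs Z (map leaf vs'))))
    ≡⟨ cong suc (sym (Φ-chain Z {ts = map leaf vs'} r∈ below-r' below-r'r)) ⟩
      suc (Φ Z (node r' (node r (map leaf vs') ∷ []))) ∎
    where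
    open NP.≤-Reasoning
    X = sumₛ (S - r' - r) (cost Z r)

  Φ-belowRoot : ∀ Z Z' {S r c c'} → vsets (c ∷ []) ≡ S - r → vsets (c' ∷ []) ≡ S - r →
    (∀ v → cost Z' r v ≤ cost Z r v) → Φ Z' c ≤ suc (Φ Z c') →
    Φ Z' (node r (c ∷ [])) ≤ suc (Φ Z (node r (c' ∷ [])))
  Φ-belowRoot Z Z' {S} {r} {c} {c'} below below' cost≤ Φ≤ = begin
      sumₛ (vsets (c ∷ [])) (cost Z' r) + (Φ Z' c + 0)
    ≡⟨ cong₂ (λ P x → sumₛ P (cost Z' r) + x) below (NP.+-identityʳ _) ⟩
      sumₛ (S - r) (cost Z' r) + Φ Z' c
    ≤⟨ NP.+-mono-≤ (sumₛ-mono (S - r) (λ v _ → cost≤ v)) Φ≤ ⟩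
      sumₛ (S - r) (cost Z r) + suc (Φ Z c')
    ≡⟨ NP.+-suc _ _ ⟩
      suc (sumₛ (S - r) (cost Z r) + Φ Z c')
    ≡⟨ cong suc (sym (cong₂ (λ P x → sumₛ P (cost Z r) + x) below' (NP.+-identityʳ _))) ⟩
      suc (Φ Z (node r (c' ∷ []))) ∎
    where open NP.≤-Reasoning

  -- The last component lets a step below a common root be lifted: the root's costs do not grow.
  Step : Subset N → Tree N → Tree N → Marks → Set
  Step S t u Z = ∃ λ Z' → LeavesMarked Z' t × Φ Z' t ≤ suc (Φ Z u) × (∀ w → w ∉ S → ∀ v → cost Z' w v ≤ cost Z w v)

  rotation-swapConnected : ∀ {S r r' d₁ d₂} Z → r ≢ r' →
    IsST S (node r (node r' (d₁ ∷ []) ∷ [])) → IsST S (node r' (node r (d₂ ∷ []) ∷ [])) →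
    IsST (S - r) (node r' (d₁ ∷ [])) → IsST (S - r') (node r (d₂ ∷ [])) →
    IsST (S - r - r') d₁ → IsST (S - r' - r) d₂ → HasX (S - r - r') →
    Rotated (tubes (node r (node r' (d₁ ∷ []) ∷ []))) (tubes (node r' (node r (d₂ ∷ []) ∷ []))) →
    LeavesMarked Z (node r' (node r (d₂ ∷ []) ∷ [])) →
    Step S (node r (node r' (d₁ ∷ []) ∷ [])) (node r' (node r (d₂ ∷ []) ∷ [])) Z
  rotation-swapConnected {S} {r} {r'} {d₁} {d₂} Z r≢r' ht hu sc sc' sd sd' hx₂ d ((marked , tt) , tt) =
    Z , ((proj₂ same marked , tt) , tt) ,
    Φ-swap Z {S} {r} {r'} {d₁ ∷ []} {d₂ ∷ []} r'∈ r∈ (vsets-children ht) (vsets-children hu) (vsets-children sc) (vsets-children sc') (cong (_+ 0) (proj₁ same)) ,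
    (λ _ _ _ → NP.≤-refl)
    where
    r'∈ = x∈p∧x≢y⇒x∈p-y (root∈S hu) (≢-sym r≢r')
    r∈ = x∈p∧x≢y⇒x∈p-y (root∈S ht) r≢r'
    a∈ = childTube r (node r' (d₁ ∷ [])) (vset∈tubes sc)
    a∉ = Escapes⇒∉tubes hu (r , root∈S ht , x∉p-x) r'∈
    b∈ = childTube r' (node r (d₂ ∷ [])) (vset∈tubes sc')
    b∉ = Escapes⇒∉tubes ht (r' , root∈S hu , x∉p-x) r∈
    d₁⊆d₂ : Included (tubes d₁) (tubes d₂)
    d₁⊆d₂ {T} m = ∈onlyChildTubes sc' (∈onlyChildTubes hu T∈u (r , root∈S ht , ∉tubes-of sd m (x∉p-x ∘ x∈p-y⇒x∈p)))
                    (r , r∈ , ∉tubes-of sd m (x∉p-x ∘ x∈p-y⇒x∈p))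
      where
      T∈u = Rotated-unique _ _ d a∈ a∉ b∈ b∉ (childTube r (node r' (d₁ ∷ [])) (childTube r' d₁ m))
              (λ e → ∉tubes-of sd m x∉p-x (subst (r' ∈_) (sym e) r'∈))
    d₂⊆d₁ : Included (tubes d₂) (tubes d₁)
    d₂⊆d₁ {T} m = ∈onlyChildTubes sc (∈onlyChildTubes ht T∈t (r' , root∈S hu , ∉tubes-of sd' m (x∉p-x ∘ x∈p-y⇒x∈p)))
                    (r' , r'∈ , ∉tubes-of sd' m (x∉p-x ∘ x∈p-y⇒x∈p))
      where
      T∈t = Rotated-unique _ _ (Rotated-sym _ _ d) b∈ b∉ a∈ a∉ (childTube r' (node r (d₂ ∷ [])) (childTube r d₂ m))
              (λ e → ∉tubes-of sd' m x∉p-x (subst (r ∈_) (sym e) r∈))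
    same = sameTubes⇒sameΦ (S - r - r') d₁ d₂ hx₂ sd (subst (λ X → IsST X d₂) (SP.p─x─y≡p─y─x S r' r) sd') d₁⊆d₂ d₂⊆d₁ Z

  rotation-swapLeaves : ∀ {S r r' vs vs'} Z → r ≢ r' → HasX (S - r) → ¬ HasX (S - r - r') →
    IsST S (node r (node r' (map leaf vs) ∷ [])) → IsST S (node r' (node r (map leaf vs') ∷ [])) →
    IsST (S - r) (node r' (map leaf vs)) → IsST (S - r') (node r (map leaf vs')) →
    (∀ v → v ∈ₗ vs → v ∈ S - r - r') → (∀ v → v ∈ S - r' - r → v ∈ₗ vs') →
    LeavesMarked Z (node r' (node r (map leaf vs') ∷ [])) →
    Step S (node r (node r' (map leaf vs) ∷ [])) (node r' (node r (map leaf vs') ∷ [])) Z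
  rotation-swapLeaves {S} {r} {r'} {vs} {vs'} Z r≢r' hxr nx₂ ht hu sc sc' vs⊆ ⊆vs' (marked , tt) =
    Z , (LeavesMarked-node Z r' vs (Marked-x Z r' (remainderWithoutX⇒rootX hxr nx₂))
           (λ v v∈ → LeavesMarked-node⁻ Z r vs' marked v (⊆vs' v (subst (v ∈_) (SP.p─x─y≡p─y─x S r r') (vs⊆ v v∈)))) , tt) ,
    Φ-swap Z {S} {r} {r'} {map leaf vs} {map leaf vs'} (x∈p∧x≢y⇒x∈p-y (root∈S hu) (≢-sym r≢r')) (x∈p∧x≢y⇒x∈p-y (root∈S ht) r≢r')
           (vsets-children ht) (vsets-children hu) (vsets-children sc) (vsets-children sc') (trans (Φs-leaves Z vs) (sym (Φs-leaves Z vs'))) ,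
    (λ _ _ _ → NP.≤-refl)

  rotation-¬connectedVsLeaves : ∀ {S r r' r₂ ts₂ r₂' ts₂'} → r ≢ r' →
    IsST S (node r (node r₂ ts₂ ∷ [])) → IsST S (node r' (node r₂' ts₂' ∷ [])) →
    IsST (S - r) (node r₂ ts₂) → IsST (S - r') (node r₂' ts₂') → HasX (S - r - r₂) → ¬ HasX (S - r' - r₂') →
    Rotated (tubes (node r (node r₂ ts₂ ∷ []))) (tubes (node r' (node r₂' ts₂' ∷ []))) → ⊥
  rotation-¬connectedVsLeaves {S} {r} {r'} {r₂} {ts₂} {r₂'} {ts₂'} r≢r' ht hu sc sc' hx₂ nx₂' d
    with rotation-connectedGrandchild ht hu r≢r' sc hx₂ d (childTube r' (node r₂' ts₂') (vset∈tubes sc'))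
           (Escapes⇒∉tubes ht (r' , root∈S hu , x∉p-x) (x∈p∧x≢y⇒x∈p-y (root∈S ht) r≢r'))
  ... | refl , a₂∈ with disconnected⇒leaves sc' nx₂'
  ...   | vs' , refl , s' , c' =
    leafTube-withoutX vs'
      (∈childTubes sc' (∈onlyChildTubes hu a₂∈ (r , root∈S ht , x∉p-x ∘ x∈p-y⇒x∈p)) (r , x∈p∧x≢y⇒x∈p-y (root∈S ht) r≢r' , x∉p-x ∘ x∈p-y⇒x∈p))
      (λ v v∈ → remainderWithoutX⇒Y nx₂' (x∈p-y⇒x∈p (s' v v∈)) (x∈p-y⇒x≢y (s' v v∈))) hx₂

  rotation-bothConnected : ∀ {S r r' ts ts'} Z → r ≢ r' → IsST S (node r ts) → IsST S (node r' ts') →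
    HasX (S - r) → HasX (S - r') → Rotated (tubes (node r ts)) (tubes (node r' ts')) →
    LeavesMarked Z (node r' ts') → Step S (node r ts) (node r' ts') Z
  rotation-bothConnected {S} {r} {r'} Z r≢r' ht hu hxr hxr' d vu
    with connected⇒oneChild ht hxr | connected⇒oneChild hu hxr'
  ... | node r₂ ts₂ , refl , sc | node r₂' ts₂' , refl , sc' with hasX? (S - r - r₂) | hasX? (S - r' - r₂')
  ...   | yes hx₂ | yes hx₂'
    with rotation-connectedGrandchild ht hu r≢r' sc hx₂ d b∈ b∉
       | rotation-connectedGrandchild hu ht (≢-sym r≢r') sc' hx₂' (Rotated-sym _ _ d) a∈ a∉
    where
    a∈ = childTube r (node r₂ ts₂) (vset∈tubes sc)
    a∉ = Escapes⇒∉tubes hu (r , root∈S ht , x∉p-x) (x∈p∧x≢y⇒x∈p-y (root∈S hu) (≢-sym r≢r'))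
    b∈ = childTube r' (node r₂' ts₂') (vset∈tubes sc')
    b∉ = Escapes⇒∉tubes ht (r' , root∈S hu , x∉p-x) (x∈p∧x≢y⇒x∈p-y (root∈S ht) r≢r')
  ...     | refl , _ | refl , _ with connected⇒oneChild sc hx₂ | connected⇒oneChild sc' hx₂'
  ...       | d₁ , refl , sd | d₂ , refl , sd' = rotation-swapConnected Z r≢r' ht hu sc sc' sd sd' hx₂ d vu
  rotation-bothConnected Z r≢r' ht hu hxr hxr' d vu | node r₂ ts₂ , refl , sc | _ , refl , sc' | yes hx₂ | no nx₂' =
    ⊥-elim (rotation-¬connectedVsLeaves r≢r' ht hu sc sc' hx₂ nx₂' d)
  rotation-bothConnected Z r≢r' ht hu hxr hxr' d vu | _ , refl , sc | _ , refl , sc' | no nx₂ | yes hx₂' =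
    ⊥-elim (rotation-¬connectedVsLeaves (≢-sym r≢r') hu ht sc' sc hx₂' nx₂ (Rotated-sym _ _ d))
  rotation-bothConnected {S} {r} {r'} Z r≢r' ht hu hxr hxr' d vu
    | node r₂ ts₂ , refl , sc | node r₂' ts₂' , refl , sc' | no nx₂ | no nx₂'
    with disconnected⇒leaves sc nx₂ | disconnected⇒leaves sc' nx₂'
  ... | vs , refl , s , c | vs' , refl , s' , c'
    with rotation-leafGrandchildren ht hu r≢r' sc c d (childTube r' (node r₂' (map leaf vs')) (vset∈tubes sc'))
           (Escapes⇒∉tubes ht (r' , root∈S hu , x∉p-x) (x∈p∧x≢y⇒x∈p-y (root∈S ht) r≢r'))
       | rotation-leafGrandchildren hu ht (≢-sym r≢r') sc' c' (Rotated-sym _ _ d) (childTube r (node r₂ (map leaf vs)) (vset∈tubes sc))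
           (Escapes⇒∉tubes hu (r , root∈S ht , x∉p-x) (x∈p∧x≢y⇒x∈p-y (root∈S hu) (≢-sym r≢r')))
  ... | refl | refl = rotation-swapLeaves Z r≢r' hxr nx₂ ht hu sc sc' s c' vu

  rotation-dropY : ∀ {S r r' ts ts'} Z → HasX S → r ≢ r' → IsST S (node r ts) → IsST S (node r' ts') →
    HasX (S - r) → ¬ HasX (S - r') → Rotated (tubes (node r ts)) (tubes (node r' ts')) →
    LeavesMarked Z (node r' ts') → Step S (node r ts) (node r' ts') Z
  rotation-dropY {S} {r} {r'} Z hx r≢r' ht hu hxr nxr' d vu with connected⇒oneChild ht hxr | disconnected⇒leaves hu nxr'
  ... | node r₂ ts₂ , refl , sc | vs' , refl , s' , c' with rotation-againstLeaves hx ht hu r≢r' sc nxr' c' s' d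
  ...   | refl , nx₂ with disconnected⇒leaves sc nx₂
  ...     | vs , refl , s , c =
    Z , (LeavesMarked-node Z r' vs (Marked-x Z r' r'-x) (λ v v∈ → LeavesMarked-node⁻ Z r' vs' vu v (c' v (∈S-r' (s v v∈)))) , tt) ,
    NP.≤-reflexive (Φ-dropY Z {S} {r} {r'} {vs} {vs'} (x∈p∧x≢y⇒x∈p-y (root∈S hu) (≢-sym r≢r')) r∈ (vsets-children ht) (vsets-children sc) (vsets-children hu)
                            (cost-yx Z r r' r-y r'-x r-marked) r-costs≡0) ,
    (λ _ _ _ → NP.≤-refl)
    where
    r'-x : IsX r'
    r'-x = remainderWithoutX⇒rootX hx nxr'
    r∈ : r ∈ S - r'
    r∈ = x∈p∧x≢y⇒x∈p-y (root∈S ht) r≢r'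
    r-y : IsY r
    r-y = remainderWithoutX⇒Y nxr' (root∈S ht) r≢r'
    r-marked : Marked Z r
    r-marked = LeavesMarked-node⁻ Z r' vs' vu r (c' r r∈)
    ∈S-r' : ∀ {v} → v ∈ S - r - r' → v ∈ S - r'
    ∈S-r' v∈ = x∈p∧x≢y⇒x∈p-y (x∈p-y⇒x∈p (x∈p-y⇒x∈p v∈)) (x∈p-y⇒x≢y v∈)
    r-costs≡0 : sumₛ (S - r - r') (cost Z r) ≡ 0
    r-costs≡0 = sumₛ-vanishing (S - r - r') λ v v∈ →
      cost-yy Z r v r-y (remainderWithoutX⇒Y nxr' (x∈p-y⇒x∈p (∈S-r' v∈)) (x∈p-y⇒x≢y (∈S-r' v∈))) r-marked
              (LeavesMarked-node⁻ Z r' vs' vu v (c' v (∈S-r' v∈)))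

  -- In t the independent vertex r' is a leaf, so it is added to the marks; costs out of the clique root r ignore marks.
  rotation-liftY : ∀ {S r r' ts ts'} Z → HasX S → r ≢ r' → IsST S (node r ts) → IsST S (node r' ts') →
    ¬ HasX (S - r) → HasX (S - r') → Rotated (tubes (node r ts)) (tubes (node r' ts')) →
    LeavesMarked Z (node r' ts') → Step S (node r ts) (node r' ts') Z
  rotation-liftY {S} {r} {r'} Z hx r≢r' ht hu nxr hxr' d vu with disconnected⇒leaves ht nxr | connected⇒oneChild hu hxr'
  ... | vs , refl , s , c | node r₂' ts₂' , refl , sc' with rotation-againstLeaves hx hu ht (≢-sym r≢r') sc' nxr c s (Rotated-sym _ _ d)
  ...   | refl , nx₂' with disconnected⇒leaves sc' nx₂' | remainderWithoutX⇒Y nxr (root∈S hu) (≢-sym r≢r')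
  ...     | vs'' , refl , s'' , c'' | j , split≡ =
    mark Z j , LeavesMarked-node (mark Z j) r vs (Marked-x _ r r-x) leaves-marked ,
    Φ-liftY Z (mark Z j) {S} {r} {r'} {vs} {vs''} r-x (x∈p∧x≢y⇒x∈p-y (root∈S hu) (≢-sym r≢r')) (x∈p∧x≢y⇒x∈p-y (root∈S ht) r≢r')
            (vsets-children ht) (vsets-children hu) (vsets-children sc') ,
    (λ w w∉ v → cost-mark Z j w v (λ e → w∉ (subst (_∈ S) (sym (trans e yj≡r')) (root∈S hu))))
    where
    r-x : IsX r
    r-x = remainderWithoutX⇒rootX hx nxr
    yj≡r' : yv p q j ≡ r'
    yj≡r' = FP.splitAt⁻¹-↑ʳ split≡
    leaves-marked : ∀ v → v ∈ₗ vs → Marked (mark Z j) v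
    leaves-marked v v∈ with v FP.≟ r'
    ... | yes refl = subst (Marked (mark Z j)) yj≡r' (Marked-mark-self Z j)
    ... | no v≢r' = Marked-mark Z j v (LeavesMarked-node⁻ Z r vs'' (proj₁ vu) v
                      (c'' v (subst (v ∈_) (SP.p─x─y≡p─y─x S r r') (x∈p∧x≢y⇒x∈p-y (s v v∈) v≢r'))))

  rotation-newRoot : ∀ {S r r' ts ts'} Z → HasX S → r ≢ r' → IsST S (node r ts) → IsST S (node r' ts') →
    Rotated (tubes (node r ts)) (tubes (node r' ts')) → LeavesMarked Z (node r' ts') → Step S (node r ts) (node r' ts') Z
  rotation-newRoot {S} {r} {r'} Z hx r≢r' ht hu d vu with hasX? (S - r) | hasX? (S - r')
  ... | yes hxr | yes hxr' = rotation-bothConnected Z r≢r' ht hu hxr hxr' d vu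
  ... | yes hxr | no nxr' = rotation-dropY Z hx r≢r' ht hu hxr nxr' d vu
  ... | no nxr | yes hxr' = rotation-liftY Z hx r≢r' ht hu nxr hxr' d vu
  ... | no nxr | no nxr' = ⊥-elim (nxr (r' , x∈p∧x≢y⇒x∈p-y (root∈S hu) (≢-sym r≢r') , remainderWithoutX⇒rootX hx nxr'))

  rotation-step : ∀ S t u → HasX S → IsST S t → IsST S u → Rotated (tubes t) (tubes u) → ∀ Z → LeavesMarked Z u → Step S t u Z
  rotation-step S (node r ts) (node r' ts') hx ht hu d Z vu with r FP.≟ r'
  ... | no r≢r' = rotation-newRoot Z hx r≢r' ht hu d vu
  ... | yes refl with hasX? (S - r)
  ...   | no nxr with disconnected⇒leaves ht nxr | disconnected⇒leaves hu nxr
  ...     | vs , refl , s₁ , c₁ | vs' , refl , s₂ , c₂ =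
    ⊥-elim ([ (λ { (T , a , b) → b (leafTubes-included s₁ c₂ ht hu a) }) , (λ { (T , a , b) → b (leafTubes-included s₂ c₁ hu ht a) }) ]′ (proj₂ d))
  rotation-step S (node r ts) (node r' ts') hx ht hu d Z vu | yes refl | yes hxr
    with connected⇒oneChild ht hxr | connected⇒oneChild hu hxr
  ... | c , refl , sc | c' , refl , sc' with rotation-step (S - r) c c' hxr sc sc' (Rotated-onlyChild ht hu sc sc' d) Z (proj₁ vu)
  ...   | Z' , marked' , Φ≤ , cost≤ =
    Z' , (marked' , tt) , Φ-belowRoot Z Z' {S} {r} {c} {c'} (vsets-children ht) (vsets-children hu) (cost≤ r x∉p-x) Φ≤ ,
    (λ w w∉ v → cost≤ w (w∉ ∘ x∈p-y⇒x∈p) v)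

  rotationPath-Φ : ∀ {t w m} → RotPath Adj t w m → IsST ⊤ t → HasX ⊤ → ∀ Z → LeavesMarked Z w →
                   ∃ λ Z' → LeavesMarked Z' t × Φ Z' t ≤ m + Φ Z w
  rotationPath-Φ done ht hx Z vw = Z , vw , NP.≤-refl
  rotationPath-Φ {t} (next {u = u} hu rot rest) ht hx Z vw with rotationPath-Φ rest hu hx Z vw
  ... | Z₁ , v₁ , Φ≤ with rotation-step ⊤ t u hx ht hu (rotation⇒Rotated _ _ rot) Z₁ v₁
  ...   | Z' , v' , Φ≤′ , _ = Z' , v' , NP.≤-trans Φ≤′ (s≤s Φ≤)

module Ordered (p q β : ℕ) (ρ : Fin (p + q) → ℕ) (ord : List (Fin (p + q)))
               (sorted : AllPairs (λ a b → ρ a < ρ b) ord) (complete : ∀ v → v ∈ₗ ord) where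
  open Potential p q β

  firstIn-minimal : ∀ (os : List V) → AllPairs (λ a b → ρ a < ρ b) os → ∀ S {r} → firstIn os S ≡ just r →
                    ∀ v → v ∈ S → v ∈ₗ os → v ≢ r → ρ r < ρ v
  firstIn-minimal (w ∷ ws) (w< ∷ ws<) S e v v∈ v∈os v≢r with w SP.∈? S
  firstIn-minimal (w ∷ ws) (w< ∷ ws<) S refl v v∈ (here refl) v≢r | yes _ = ⊥-elim (v≢r refl)
  firstIn-minimal (w ∷ ws) (w< ∷ ws<) S refl v v∈ (there v∈ws) v≢r | yes _ = All.lookup w< v∈ws
  firstIn-minimal (w ∷ ws) (w< ∷ ws<) S e v v∈ (here refl) v≢r | no w∉ = ⊥-elim (w∉ v∈)
  firstIn-minimal (w ∷ ws) (w< ∷ ws<) S e v v∈ (there v∈ws) v≢r | no w∉ = firstIn-minimal ws ws< S e v v∈ v∈ws v≢r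

  root-minimal : ∀ {S r} → firstIn ord S ≡ just r → ∀ v → v ∈ S - r → ρ r < ρ v
  root-minimal e v v∈ = firstIn-minimal ord sorted _ e v (x∈p-y⇒x∈p v∈) (complete v) (x∈p-y⇒x≢y v∈)

  FinalSegment : Subset N → Set
  FinalSegment S = ∀ a b → a ∉ S → b ∈ S → ρ a < ρ b

  FinalSegment-remove : ∀ {S r} → firstIn ord S ≡ just r → FinalSegment S → FinalSegment (S - r)
  FinalSegment-remove {S} {r} e fin a b a∉ b∈ with a FP.≟ r
  ... | yes refl = root-minimal e b b∈
  ... | no a≢r = fin a b (λ a∈ → a∉ (x∈p∧x≢y⇒x∈p-y a∈ a≢r)) (x∈p-y⇒x∈p b∈)

  FinalSegment-⊤ : FinalSegment ⊤
  FinalSegment-⊤ a b a∉ _ = ⊥-elim (a∉ SP.∈⊤)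

  mutual
    Φ≡0 : ∀ {S t} Z → Assoc Adj ord S t → (∀ a b → ρ a < ρ b → cost Z a b ≡ 0) → Φ Z t ≡ 0
    Φ≡0 {S} {node r ts} Z h@(as r∈ e allA cp) cost≡0 =
      cong₂ _+_ (sumₛ-vanishing (vsets ts) (λ v v∈ → cost≡0 r v (root-minimal e v (vsets⊆ (assoc⇒st h) v∈))))
                (Φs≡0 Z allA cost≡0)

    Φs≡0 : ∀ {ts} Z → All (λ c → Assoc Adj ord (vset c) c) ts → (∀ a b → ρ a < ρ b → cost Z a b ≡ 0) → Φs Z ts ≡ 0
    Φs≡0 Z [] cost≡0 = refl
    Φs≡0 Z (a ∷ as') cost≡0 = cong₂ _+_ (Φ≡0 Z a cost≡0) (Φs≡0 Z as' cost≡0)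

  assoc-LeavesMarked : ∀ {S t} Z → Assoc Adj ord S t → HasX S → FinalSegment S →
                       (∀ y → IsY y → (∀ x → IsX x → ρ x < ρ y) → Marked Z y) → LeavesMarked Z t
  assoc-LeavesMarked {S} {node r ts} Z h@(as r∈ e allA cp) hx fin marked with hasX? (S - r)
  ... | yes hxr with connected⇒oneChild (assoc⇒st h) hxr | allA
  ...   | c , refl , sc | a ∷ [] =
    assoc-LeavesMarked Z (subst (λ X → Assoc Adj ord X c) (vset-searchTree sc) a) hxr (FinalSegment-remove e fin) marked , tt
  assoc-LeavesMarked {S} {node r ts} Z h@(as r∈ e allA cp) hx fin marked | no nxr with disconnected⇒leaves (assoc⇒st h) nxr
  ... | vs , refl , s , c = LeavesMarked-node Z r vs (Marked-x Z r (remainderWithoutX⇒rootX hx nxr))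
    (λ v v∈ → marked v (remainderWithoutX⇒Y nxr (x∈p-y⇒x∈p (s v v∈)) (x∈p-y⇒x≢y (s v v∈)))
                       (λ x xx → FinalSegment-remove e fin x v (λ x∈ → nxr (x , x∈ , xx)) (s v v∈)))

  forwardCost : Marks → V → V → ℕ
  forwardCost Z a b with ρ a ℕ.<? ρ b
  ... | yes _ = cost Z a b
  ... | no _ = 0

  forwardCost-< : ∀ Z a b → ρ a < ρ b → forwardCost Z a b ≡ cost Z a b
  forwardCost-< Z a b a<b with ρ a ℕ.<? ρ b
  ... | yes _ = refl
  ... | no a≮b = ⊥-elim (a≮b a<b)

  forwardCost-≥ : ∀ Z a b → ρ b ≤ ρ a → forwardCost Z a b ≡ 0
  forwardCost-≥ Z a b b≤a with ρ a ℕ.<? ρ b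
  ... | yes a<b = ⊥-elim (NP.<-irrefl refl (NP.<-≤-trans a<b b≤a))
  ... | no _ = refl

  pairCost : Marks → Subset N → ℕ
  pairCost Z S = sumₛ S (λ a → sumₛ S (forwardCost Z a))

  pairCost-remove : ∀ Z {S r} → r ∈ S → (∀ v → v ∈ S - r → ρ r < ρ v) →
                    pairCost Z S ≡ sumₛ (S - r) (cost Z r) + pairCost Z (S - r)
  pairCost-remove Z {S} {r} r∈ r-min = begin
      pairCost Z S
    ≡⟨ sumₛ-remove S (λ a → sumₛ S (forwardCost Z a)) r∈ ⟩
      sumₛ S (forwardCost Z r) + sumₛ (S - r) (λ a → sumₛ S (forwardCost Z a))
    ≡⟨ cong₂ _+_ (sumₛ-remove S (forwardCost Z r) r∈) (sumₛ-cong (S - r) (λ a a∈ → sumₛ-remove S (forwardCost Z a) r∈)) ⟩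
      (forwardCost Z r r + sumₛ (S - r) (forwardCost Z r)) + sumₛ (S - r) (λ a → forwardCost Z a r + sumₛ (S - r) (forwardCost Z a))
    ≡⟨ cong₂ _+_ (cong₂ _+_ (forwardCost-≥ Z r r NP.≤-refl) (sumₛ-cong (S - r) (λ v v∈ → forwardCost-< Z r v (r-min v v∈))))
                 (sumₛ-cong (S - r) (λ a a∈ → cong (_+ sumₛ (S - r) (forwardCost Z a)) (forwardCost-≥ Z a r (NP.<⇒≤ (r-min a a∈))))) ⟩
      sumₛ (S - r) (cost Z r) + pairCost Z (S - r) ∎
    where open ≡-Reasoning

  -- A clique vertex is ranked last, so the associated tree is a path and Φ counts every ranked pair.
  Φ≡pairCost : ∀ {S t} Z → Assoc Adj ord S t → FinalSegment S → (xTop : V) → IsX xTop → (∀ v → ρ v ≤ ρ xTop) →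
               Φ Z t ≡ pairCost Z S
  Φ≡pairCost {S} {node r ts} Z h@(as r∈ e allA cp) fin xTop xTop-x top with hasX? (S - r)
  ... | yes hxr with connected⇒oneChild (assoc⇒st h) hxr | allA
  ...   | c , refl , sc | a ∷ [] =
    trans (cong₂ (λ P Q → sumₛ P (cost Z r) + Q) (vsets-children (assoc⇒st h))
                 (trans (NP.+-identityʳ _) (Φ≡pairCost Z (subst (λ X → Assoc Adj ord X c) (vset-searchTree sc) a) (FinalSegment-remove e fin) xTop xTop-x top)))
          (sym (pairCost-remove Z r∈ (root-minimal e)))
  Φ≡pairCost {S} {node r ts} Z h@(as r∈ e allA cp) fin xTop xTop-x top | no nxr with disconnected⇒leaves (assoc⇒st h) nxr
  ... | vs , refl , s , c =
    trans (cong₂ (λ P Q → sumₛ P (cost Z r) + Q) (vsets-children (assoc⇒st h))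
                 (trans (Φs-leaves Z vs) (sym (sumₛ-vanishing (S - r) (λ v v∈ → ⊥-elim (remainder-empty v v∈))))))
          (sym (pairCost-remove Z r∈ (root-minimal e)))
    where
    remainder-empty : ∀ v → v ∉ S - r
    remainder-empty v v∈ with xTop SP.∈? (S - r)
    ... | yes xTop∈ = nxr (xTop , xTop∈ , xTop-x)
    ... | no xTop∉ = NP.<-irrefl refl (NP.<-≤-trans (FinalSegment-remove e fin xTop v xTop∉ v∈) (top v))
module Ranks (p' q α β : ℕ) (β<q : β < q) (α≤p' : α ≤ p') where
  p : ℕ
  p = suc p'
  open Potential p q β public

  InRange : ℕ → ℕ → ℕ → Set
  InRange a b i = T ((a ≤ᵇ i) ∧ (i <ᵇ b))

  InRange⁻ : ∀ {a b i} → InRange a b i → a ≤ i × i < b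
  InRange⁻ {a} {b} {i} h = let (h1 , h2) = to BP.T-∧ h in NP.≤ᵇ⇒≤ a i h1 , NP.<ᵇ⇒< i b h2

  InRange⁺ : ∀ {a b i} → a ≤ i → i < b → InRange a b i
  InRange⁺ h1 h2 = from BP.T-∧ (NP.≤⇒≤ᵇ h1 , NP.<⇒<ᵇ h2)

  inRangeX? : (a b : ℕ) (i : Fin p) → Dec (T ((a ≤ᵇ toℕ i) ∧ (toℕ i <ᵇ b)))
  inRangeX? a b i = BP.T? ((a ≤ᵇ toℕ i) ∧ (toℕ i <ᵇ b))
  inRangeY? : (a b : ℕ) (i : Fin q) → Dec (T ((a ≤ᵇ toℕ i) ∧ (toℕ i <ᵇ b)))
  inRangeY? a b i = BP.T? ((a ≤ᵇ toℕ i) ∧ (toℕ i <ᵇ b))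

  ∈xs⁻ : ∀ {a b v} → v ∈ₗ xs p q a b → ∃ λ i → v ≡ xv p q i × a ≤ toℕ i × toℕ i < b
  ∈xs⁻ {a} {b} m with MP.∈-map⁻ (xv p q) m
  ... | i , i∈ , refl = i , refl , InRange⁻ (proj₂ (MP.∈-filter⁻ (inRangeX? a b) {xs = allFin p} i∈))

  ∈xs⁺ : ∀ {a b} i → a ≤ toℕ i → toℕ i < b → xv p q i ∈ₗ xs p q a b
  ∈xs⁺ {a} {b} i h1 h2 = MP.∈-map⁺ (xv p q) (MP.∈-filter⁺ (inRangeX? a b) (MP.∈-allFin i) (InRange⁺ h1 h2))

  ∈ys⁻ : ∀ {a b v} → v ∈ₗ ys p q a b → ∃ λ j → v ≡ yv p q j × a ≤ toℕ j × toℕ j < b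
  ∈ys⁻ {a} {b} m with MP.∈-map⁻ (yv p q) m
  ... | j , j∈ , refl = j , refl , InRange⁻ (proj₂ (MP.∈-filter⁻ (inRangeY? a b) {xs = allFin q} j∈))

  ∈ys⁺ : ∀ {a b} j → a ≤ toℕ j → toℕ j < b → yv p q j ∈ₗ ys p q a b
  ∈ys⁺ {a} {b} j h1 h2 = MP.∈-map⁺ (yv p q) (MP.∈-filter⁺ (inRangeY? a b) (MP.∈-allFin j) (InRange⁺ h1 h2))

  xs-sorted : ∀ a b {R : V → V → Set} → (∀ {i k} → toℕ i < toℕ k → a ≤ toℕ i → toℕ i < b → a ≤ toℕ k → toℕ k < b → R (xv p q i) (xv p q k)) →
        AllPairs R (xs p q a b)
  xs-sorted a b h = APP.map⁺ (filter-sorted (inRangeX? a b) (λ {i} {k} lt pi pk → let (a1 , b1) = InRange⁻ pi ; (a2 , b2) = InRange⁻ pk in h lt a1 b1 a2 b2))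

  ys-sorted : ∀ a b {R : V → V → Set} → (∀ {j k} → toℕ j < toℕ k → a ≤ toℕ j → toℕ j < b → a ≤ toℕ k → toℕ k < b → R (yv p q j) (yv p q k)) →
        AllPairs R (ys p q a b)
  ys-sorted a b h = APP.map⁺ (filter-sorted (inRangeY? a b) (λ {i} {k} lt pi pk → let (a1 , b1) = InRange⁻ pi ; (a2 , b2) = InRange⁻ pk in h lt a1 b1 a2 b2))

  rank' : (Fin p → ℕ) → (Fin q → ℕ) → Fin p ⊎ Fin q → ℕ
  rank' f g (inj₁ i) = f i
  rank' f g (inj₂ j) = g j

  rank : (Fin p → ℕ) → (Fin q → ℕ) → V → ℕ
  rank f g v = rank' f g (splitAt p v)

  rank-x : ∀ f g i → rank f g (xv p q i) ≡ f i
  rank-x f g i rewrite FP.splitAt-↑ˡ p i q = refl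

  rank-y : ∀ f g j → rank f g (yv p q j) ≡ g j
  rank-y f g j rewrite FP.splitAt-↑ʳ p q j = refl


  ρ1x : Fin p → ℕ
  ρ1x i = if toℕ i <ᵇ α then toℕ i else q + toℕ i
  ρ1y : Fin q → ℕ
  ρ1y j = α + toℕ j
  ρ1 : V → ℕ
  ρ1 = rank ρ1x ρ1y

  ρ1x-lt : ∀ i → toℕ i < α → ρ1x i ≡ toℕ i
  ρ1x-lt i h rewrite <ᵇ-true h = refl
  ρ1x-ge : ∀ i → α ≤ toℕ i → ρ1x i ≡ q + toℕ i
  ρ1x-ge i h rewrite <ᵇ-false h = refl

  ρ1x-mono : ∀ {i k} → toℕ i < toℕ k → ρ1x i < ρ1x k
  ρ1x-mono {i} {k} lt with toℕ i NP.<? α | toℕ k NP.<? α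
  ... | yes a | yes b rewrite ρ1x-lt i a | ρ1x-lt k b = lt
  ... | yes a | no b rewrite ρ1x-lt i a | ρ1x-ge k (NP.≮⇒≥ b) = NP.<-≤-trans lt (NP.m≤n+m _ q)
  ... | no a | yes b = ⊥-elim (a (NP.<-trans lt b))
  ... | no a | no b rewrite ρ1x-ge i (NP.≮⇒≥ a) | ρ1x-ge k (NP.≮⇒≥ b) = NP.+-monoʳ-< q lt

  R1 : V → V → Set
  R1 a b = ρ1 a < ρ1 b

  x<1 : ∀ {i k} → ρ1x i < ρ1x k → R1 (xv p q i) (xv p q k)
  x<1 {i} {k} h = subst₂ _<_ (sym (rank-x ρ1x ρ1y i)) (sym (rank-x ρ1x ρ1y k)) h
  y<1 : ∀ {j k} → ρ1y j < ρ1y k → R1 (yv p q j) (yv p q k)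
  y<1 {j} {k} h = subst₂ _<_ (sym (rank-y ρ1x ρ1y j)) (sym (rank-y ρ1x ρ1y k)) h
  xy<1 : ∀ {i j} → ρ1x i < ρ1y j → R1 (xv p q i) (yv p q j)
  xy<1 {i} {j} h = subst₂ _<_ (sym (rank-x ρ1x ρ1y i)) (sym (rank-y ρ1x ρ1y j)) h
  yx<1 : ∀ {j i} → ρ1y j < ρ1x i → R1 (yv p q j) (xv p q i)
  yx<1 {j} {i} h = subst₂ _<_ (sym (rank-y ρ1x ρ1y j)) (sym (rank-x ρ1x ρ1y i)) h

  sorted1 : AllPairs R1 (order1 p q α)
  sorted1 = APP.++⁺ sA (APP.++⁺ sB sC cBC) cA
    where
    sA : AllPairs R1 (xs p q 0 α)
    sA = xs-sorted 0 α (λ {i} {k} lt _ _ _ _ → x<1 {i} {k} (ρ1x-mono lt))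
    sB : AllPairs R1 (ys p q 0 q)
    sB = ys-sorted 0 q (λ {j} {k} lt _ _ _ _ → y<1 {j} {k} (NP.+-monoʳ-< α lt))
    sC : AllPairs R1 (xs p q α p)
    sC = xs-sorted α p (λ {i} {k} lt _ _ _ _ → x<1 {i} {k} (ρ1x-mono lt))
    cBC : All (λ a → All (R1 a) (xs p q α p)) (ys p q 0 q)
    cBC = All-cross (ys p q 0 q) (xs p q α p) λ {a} {b} a∈ b∈ →
      let (j , e1 , _ , j<q) = ∈ys⁻ {0} {q} a∈ ; (k , e2 , α≤k , _) = ∈xs⁻ {α} {p} b∈ in
      subst₂ R1 (sym e1) (sym e2) (yx<1 {j} {k} (subst (ρ1y j <_) (sym (ρ1x-ge k α≤k))
        (NP.<-≤-trans (NP.+-monoʳ-< α j<q) (subst (_≤ q + toℕ k) (NP.+-comm q α) (NP.+-monoʳ-≤ q α≤k)))))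
    x-before : ∀ i → toℕ i < α → ∀ {b} → Any (b ≡_) (ys p q 0 q) ⊎ Any (b ≡_) (xs p q α p) → R1 (xv p q i) b
    x-before i i<α {b} (inj₁ m) = let (j , e , _ , _) = ∈ys⁻ {0} {q} m in
      subst (R1 (xv p q i)) (sym e) (xy<1 {i} {j} (subst (_< ρ1y j) (sym (ρ1x-lt i i<α)) (NP.<-≤-trans i<α (NP.m≤m+n α (toℕ j)))))
    x-before i i<α {b} (inj₂ m) = let (k , e , α≤k , _) = ∈xs⁻ {α} {p} m in
      subst (R1 (xv p q i)) (sym e) (x<1 {i} {k} (ρ1x-mono (NP.<-≤-trans i<α α≤k)))
    cA : All (λ a → All (R1 a) (ys p q 0 q ++ xs p q α p)) (xs p q 0 α)
    cA = All-cross (xs p q 0 α) (ys p q 0 q ++ xs p q α p) λ {a} {b} a∈ b∈ →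
      let (i , e1 , _ , i<α) = ∈xs⁻ {0} {α} a∈ in
      subst (λ a → R1 a b) (sym e1) (x-before i i<α (AnyP.++⁻ (ys p q 0 q) b∈))

  complete1 : ∀ v → v ∈ₗ order1 p q α
  complete1 v with x⊎y v
  ... | inj₁ (i , e) with toℕ i NP.<? α
  ...   | yes lt = subst (λ w → w ∈ₗ order1 p q α) (FP.splitAt⁻¹-↑ˡ e) (AnyP.++⁺ˡ (∈xs⁺ i z≤n lt))
  ...   | no ge = subst (λ w → w ∈ₗ order1 p q α) (FP.splitAt⁻¹-↑ˡ e)
                    (AnyP.++⁺ʳ (xs p q 0 α) (AnyP.++⁺ʳ (ys p q 0 q) (∈xs⁺ i (NP.≮⇒≥ ge) (FP.toℕ<n i))))
  complete1 v | inj₂ (j , e) = subst (λ w → w ∈ₗ order1 p q α) (FP.splitAt⁻¹-↑ʳ e)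
                    (AnyP.++⁺ʳ (xs p q 0 α) (AnyP.++⁺ˡ (∈ys⁺ j z≤n (FP.toℕ<n j))))

  ρ2x : Fin p → ℕ
  ρ2x i = if toℕ i ≡ᵇ p' then q ∸ β else q + (p' ∸ toℕ i)
  ρ2y : Fin q → ℕ
  ρ2y j = if toℕ j <ᵇ β then q ∸ toℕ j else q ∸ suc (toℕ j)
  ρ2 : V → ℕ
  ρ2 = rank ρ2x ρ2y
  R2 : V → V → Set
  R2 a b = ρ2 a < ρ2 b

  ρ2x-last : ∀ i → toℕ i ≡ p' → ρ2x i ≡ q ∸ β
  ρ2x-last i h rewrite ≡ᵇ-true h = refl
  ρ2x-oth : ∀ i → toℕ i ≢ p' → ρ2x i ≡ q + (p' ∸ toℕ i)
  ρ2x-oth i h rewrite ≡ᵇ-false h = refl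
  ρ2y-lt : ∀ j → toℕ j < β → ρ2y j ≡ q ∸ toℕ j
  ρ2y-lt j h rewrite <ᵇ-true h = refl
  ρ2y-ge : ∀ j → β ≤ toℕ j → ρ2y j ≡ q ∸ suc (toℕ j)
  ρ2y-ge j h rewrite <ᵇ-false h = refl

  i<p' : ∀ (i : Fin p) → toℕ i ≢ p' → toℕ i < p'
  i<p' i ne = NP.≤∧≢⇒< (ℕ.s≤s⁻¹ (FP.toℕ<n i)) ne

  ρ2y≤q : ∀ j → ρ2y j ≤ q
  ρ2y≤q j with toℕ j NP.<? β
  ... | yes h rewrite ρ2y-lt j h = NP.m∸n≤m q (toℕ j)
  ... | no h rewrite ρ2y-ge j (NP.≮⇒≥ h) = NP.m∸n≤m q (suc (toℕ j))

  q<ρ2x : ∀ i → toℕ i ≢ p' → q < ρ2x i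
  q<ρ2x i ne rewrite ρ2x-oth i ne = subst (_< q + (p' ∸ toℕ i)) (NP.+-identityʳ q) (NP.+-monoʳ-< q (NP.m<n⇒0<n∸m (i<p' i ne)))

  ρ2y-late : ∀ j → β ≤ toℕ j → ρ2y j < q ∸ β
  ρ2y-late j h rewrite ρ2y-ge j h = NP.∸-monoʳ-< (s≤s h) (FP.toℕ<n j)

  ρ2y-early : ∀ j → toℕ j < β → q ∸ β < ρ2y j
  ρ2y-early j h rewrite ρ2y-lt j h = NP.∸-monoʳ-< h (NP.<⇒≤ β<q)

  ρ2y-anti : ∀ {j k} → toℕ j < toℕ k → ρ2y k < ρ2y j
  ρ2y-anti {j} {k} lt with toℕ j NP.<? β | toℕ k NP.<? β
  ... | yes a | yes b rewrite ρ2y-lt j a | ρ2y-lt k b = NP.∸-monoʳ-< lt (NP.<⇒≤ (FP.toℕ<n k))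
  ... | yes a | no b rewrite ρ2y-lt j a | ρ2y-ge k (NP.≮⇒≥ b) = NP.∸-monoʳ-< (NP.m<n⇒m<1+n lt) (FP.toℕ<n k)
  ... | no a | yes b = ⊥-elim (a (NP.<-trans lt b))
  ... | no a | no b rewrite ρ2y-ge j (NP.≮⇒≥ a) | ρ2y-ge k (NP.≮⇒≥ b) = NP.∸-monoʳ-< (s≤s lt) (FP.toℕ<n k)

  ρ2x-anti : ∀ {i k} → toℕ i < toℕ k → ρ2x k < ρ2x i
  ρ2x-anti {i} {k} lt with toℕ k NP.≟ p'
  ... | yes e rewrite ρ2x-last k e = NP.≤-<-trans (NP.m∸n≤m q β) (q<ρ2x i λ e' → NP.<-irrefl (trans e' (sym e)) lt)
  ... | no ne rewrite ρ2x-oth k ne | ρ2x-oth i (λ e' → NP.<-asym lt (subst (toℕ k <_) (sym e') (i<p' k ne))) =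
        NP.+-monoʳ-< q (NP.∸-monoʳ-< lt (NP.<⇒≤ (i<p' k ne)))

  x<2 : ∀ {i k} → ρ2x i < ρ2x k → R2 (xv p q i) (xv p q k)
  x<2 {i} {k} h = subst₂ _<_ (sym (rank-x ρ2x ρ2y i)) (sym (rank-x ρ2x ρ2y k)) h
  y<2 : ∀ {j k} → ρ2y j < ρ2y k → R2 (yv p q j) (yv p q k)
  y<2 {j} {k} h = subst₂ _<_ (sym (rank-y ρ2x ρ2y j)) (sym (rank-y ρ2x ρ2y k)) h
  xy<2 : ∀ {i j} → ρ2x i < ρ2y j → R2 (xv p q i) (yv p q j)
  xy<2 {i} {j} h = subst₂ _<_ (sym (rank-x ρ2x ρ2y i)) (sym (rank-y ρ2x ρ2y j)) h
  yx<2 : ∀ {j i} → ρ2y j < ρ2x i → R2 (yv p q j) (xv p q i)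
  yx<2 {j} {i} h = subst₂ _<_ (sym (rank-y ρ2x ρ2y j)) (sym (rank-x ρ2x ρ2y i)) h

  LA = reverse (ys p q β q)
  LM = xs p q p' p
  LB = reverse (ys p q 0 β)
  LC = reverse (xs p q 0 p')

  toℕ≡p′ : ∀ {i : Fin p} → p' ≤ toℕ i → toℕ i ≡ p'
  toℕ≡p′ {i} h = NP.≤-antisym (ℕ.s≤s⁻¹ (FP.toℕ<n i)) h

  sorted2 : AllPairs R2 (order2 p q β)
  sorted2 = APP.++⁺ sA (APP.++⁺ sM (APP.++⁺ sB sC cBC) cM) cA
    where
    sA : AllPairs R2 LA
    sA = AllPairs-reverse (ys p q β q) (ys-sorted β q (λ {j} {k} lt _ _ _ _ → y<2 {k} {j} (ρ2y-anti lt)))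
    sM : AllPairs R2 LM
    sM = xs-sorted p' p (λ {i} {k} lt a1 _ _ b2 → ⊥-elim (NP.<-irrefl refl (NP.<-≤-trans (NP.≤-<-trans a1 lt) (ℕ.s≤s⁻¹ b2))))
    sB : AllPairs R2 LB
    sB = AllPairs-reverse (ys p q 0 β) (ys-sorted 0 β (λ {j} {k} lt _ _ _ _ → y<2 {k} {j} (ρ2y-anti lt)))
    sC : AllPairs R2 LC
    sC = AllPairs-reverse (xs p q 0 p') (xs-sorted 0 p' (λ {i} {k} lt _ _ _ _ → x<2 {k} {i} (ρ2x-anti lt)))
    cBC : All (λ a → All (R2 a) LC) LB
    cBC = All-cross LB LC λ {a} {b} a∈ b∈ →
      let (j , e1 , _ , _) = ∈ys⁻ {0} {β} (AnyP.reverse⁻ a∈) ; (i , e2 , _ , i<) = ∈xs⁻ {0} {p'} (AnyP.reverse⁻ b∈) in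
      subst₂ R2 (sym e1) (sym e2) (yx<2 {j} {i} (NP.≤-<-trans (ρ2y≤q j) (q<ρ2x i (λ e → NP.<-irrefl e i<))))
    xLast-before : ∀ {i : Fin p} → toℕ i ≡ p' → ∀ {b} → Any (b ≡_) LB ⊎ Any (b ≡_) LC → R2 (xv p q i) b
    xLast-before {i} ei (inj₁ m) = let (j , e , _ , j<) = ∈ys⁻ {0} {β} (AnyP.reverse⁻ m) in
      subst (R2 (xv p q i)) (sym e) (xy<2 {i} {j} (subst (_< ρ2y j) (sym (ρ2x-last i ei)) (ρ2y-early j j<)))
    xLast-before {i} ei (inj₂ m) = let (k , e , _ , k<) = ∈xs⁻ {0} {p'} (AnyP.reverse⁻ m) in
      subst (R2 (xv p q i)) (sym e) (x<2 {i} {k} (subst (_< ρ2x k) (sym (ρ2x-last i ei)) (NP.≤-<-trans (NP.m∸n≤m q β) (q<ρ2x k (λ e → NP.<-irrefl e k<)))))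
    cM : All (λ a → All (R2 a) (LB ++ LC)) LM
    cM = All-cross LM (LB ++ LC) λ {a} {b} a∈ b∈ →
      let (i , e1 , a1 , _) = ∈xs⁻ {p'} {p} a∈ in subst (λ a → R2 a b) (sym e1) (xLast-before (toℕ≡p′ a1) (AnyP.++⁻ LB b∈))
    lateY-before : ∀ {j : Fin q} → β ≤ toℕ j → ∀ {b} → Any (b ≡_) LM ⊎ (Any (b ≡_) LB ⊎ Any (b ≡_) LC) → R2 (yv p q j) b
    lateY-before {j} jβ (inj₁ m) = let (i , e , a1 , _) = ∈xs⁻ {p'} {p} m in
      subst (R2 (yv p q j)) (sym e) (yx<2 {j} {i} (subst (ρ2y j <_) (sym (ρ2x-last i (toℕ≡p′ a1))) (ρ2y-late j jβ)))
    lateY-before {j} jβ (inj₂ (inj₁ m)) = let (k , e , _ , k<) = ∈ys⁻ {0} {β} (AnyP.reverse⁻ m) in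
      subst (R2 (yv p q j)) (sym e) (y<2 {j} {k} (NP.<-trans (ρ2y-late j jβ) (ρ2y-early k k<)))
    lateY-before {j} jβ (inj₂ (inj₂ m)) = let (i , e , _ , i<) = ∈xs⁻ {0} {p'} (AnyP.reverse⁻ m) in
      subst (R2 (yv p q j)) (sym e) (yx<2 {j} {i} (NP.≤-<-trans (ρ2y≤q j) (q<ρ2x i (λ e → NP.<-irrefl e i<))))
    cA : All (λ a → All (R2 a) (LM ++ (LB ++ LC))) LA
    cA = All-cross LA (LM ++ (LB ++ LC)) λ {a} {b} a∈ b∈ →
      let (j , e1 , jβ , _) = ∈ys⁻ {β} {q} (AnyP.reverse⁻ a∈) in
      subst (λ a → R2 a b) (sym e1) (lateY-before jβ (Data.Sum.map₂ (AnyP.++⁻ LB) (AnyP.++⁻ LM b∈)))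

  complete2 : ∀ v → v ∈ₗ order2 p q β
  complete2 v with x⊎y v
  ... | inj₁ (i , e) with toℕ i NP.≟ p'
  ...   | yes ei = subst (λ w → w ∈ₗ order2 p q β) (FP.splitAt⁻¹-↑ˡ e)
                    (AnyP.++⁺ʳ LA (AnyP.++⁺ˡ (∈xs⁺ i (NP.≤-reflexive (sym ei)) (FP.toℕ<n i))))
  ...   | no ne = subst (λ w → w ∈ₗ order2 p q β) (FP.splitAt⁻¹-↑ˡ e)
                    (AnyP.++⁺ʳ LA (AnyP.++⁺ʳ LM (AnyP.++⁺ʳ LB (AnyP.reverse⁺ (∈xs⁺ i z≤n (i<p' i ne))))))
  complete2 v | inj₂ (j , e) with toℕ j NP.<? β
  ... | yes lt = subst (λ w → w ∈ₗ order2 p q β) (FP.splitAt⁻¹-↑ʳ e)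
                    (AnyP.++⁺ʳ LA (AnyP.++⁺ʳ LM (AnyP.++⁺ˡ (AnyP.reverse⁺ (∈ys⁺ j z≤n lt)))))
  ... | no ge = subst (λ w → w ∈ₗ order2 p q β) (FP.splitAt⁻¹-↑ʳ e)
                    (AnyP.++⁺ˡ (AnyP.reverse⁺ (∈ys⁺ j (NP.≮⇒≥ ge) (FP.toℕ<n j))))

  -- When p = 1, the vertices y₁, …, y_β are leaves of T₂ and must be marked.
  Z₀ : Marks
  Z₀ j = (p' ≡ᵇ 0) ∧ (toℕ j <ᵇ β)

  cost'-Z₀ : ∀ s s' → rank' ρ2x ρ2y s < rank' ρ2x ρ2y s' → cost' Z₀ s s' ≡ 0
  cost'-Z₀ (inj₁ i) (inj₁ k) h with toℕ i NP.<? toℕ k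
  ... | yes lt = ⊥-elim (NP.<-asym h (ρ2x-anti lt))
  ... | no ge rewrite <ᵇ-false (NP.≮⇒≥ ge) = refl
  cost'-Z₀ (inj₁ i) (inj₂ j) h with toℕ i NP.≟ p'
  ... | no ne = ⊥-elim (NP.<-asym h (NP.≤-<-trans (ρ2y≤q j) (q<ρ2x i ne)))
  ... | yes ei with toℕ j NP.<? β
  ...   | yes jb rewrite ≡ᵇ-true ei | <ᵇ-true jb = refl
  ...   | no jb = ⊥-elim (NP.<-asym (subst (_< ρ2y j) (ρ2x-last i ei) h) (ρ2y-late j (NP.≮⇒≥ jb)))
  cost'-Z₀ (inj₂ j) (inj₁ i) h with toℕ i NP.≟ p'
  ... | yes ei with toℕ j NP.<? β
  ...   | yes jb = ⊥-elim (NP.<-asym (subst (ρ2y j <_) (ρ2x-last i ei) h) (ρ2y-early j jb))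
  ...   | no jb rewrite <ᵇ-false (NP.≮⇒≥ jb) | BP.∧-zeroʳ (p' ≡ᵇ 0) | ≡ᵇ-true ei = refl
  cost'-Z₀ (inj₂ j) (inj₁ i) h | no ne rewrite ≡ᵇ-false {p'} {0} (λ e → NP.<-irrefl refl (NP.<-≤-trans (subst (toℕ i <_) e (i<p' i ne)) z≤n)) | ≡ᵇ-false ne = refl
  cost'-Z₀ (inj₂ j) (inj₂ k) h with toℕ j NP.<? toℕ k
  ... | yes lt = ⊥-elim (NP.<-asym h (ρ2y-anti lt))
  ... | no ge rewrite <ᵇ-false (NP.≮⇒≥ ge) with Z₀ j ∧ Z₀ k
  ...   | true = refl
  ...   | false = refl

  cost-Z₀ : ∀ a b → ρ2 a < ρ2 b → cost Z₀ a b ≡ 0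
  cost-Z₀ a b h = cost'-Z₀ (splitAt p a) (splitAt p b) h

  xFirst : Fin p
  xFirst = F.zero

  Z₀-marksLateY : ∀ y → IsY y → (∀ x → IsX x → ρ2 x < ρ2 y) → Marked Z₀ y
  Z₀-marksLateY y (j , e) h with h (xv p q xFirst) (xFirst , FP.splitAt-↑ˡ p xFirst q)
  ... | lt rewrite rank-x ρ2x ρ2y xFirst | e with p' NP.≟ 0
  ...   | yes e0 rewrite ρ2x-last xFirst (sym e0) | ≡ᵇ-true e0 with toℕ j NP.<? β
  ...     | yes jb rewrite <ᵇ-true jb = tt
  ...     | no jb = ⊥-elim (NP.<-asym lt (ρ2y-late j (NP.≮⇒≥ jb)))
  Z₀-marksLateY y (j , e) h | lt | no n0 rewrite ρ2x-oth xFirst (λ e' → n0 (sym e')) =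
    ⊥-elim (NP.<-asym lt (NP.≤-<-trans (ρ2y≤q j) (subst (_< q + p') (NP.+-identityʳ q) (NP.+-monoʳ-< q (NP.n≢0⇒n>0 n0)))))

  xLast : Fin p
  xLast = F.fromℕ p'

  ρ1≤xLast : ∀ v → ρ1 v ≤ ρ1 (xv p q xLast)
  ρ1≤xLast v rewrite rank-x ρ1x ρ1y xLast | ρ1x-ge xLast (subst (α ≤_) (sym (FP.toℕ-fromℕ p')) α≤p') | FP.toℕ-fromℕ p' with splitAt p v
  ... | inj₁ i with toℕ i NP.<? α
  ...   | yes a rewrite ρ1x-lt i a = NP.≤-trans (NP.<⇒≤ (NP.<-≤-trans a α≤p')) (NP.m≤n+m p' q)
  ...   | no a rewrite ρ1x-ge i (NP.≮⇒≥ a) = NP.+-monoʳ-≤ q (ℕ.s≤s⁻¹ (FP.toℕ<n i))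
  ρ1≤xLast v | inj₂ j = subst (α + toℕ j ≤_) (NP.+-comm p' q) (NP.+-mono-≤ α≤p' (NP.<⇒≤ (FP.toℕ<n j)))


module LowerBound (p' q α β : ℕ) (β<q : β < q) (α≤p' : α ≤ p') where
  open Ranks p' q α β β<q α≤p' public
  module O₁ = Ordered p q β ρ1 (order1 p q α) sorted1 complete1
  open O₁ using (forwardCost; forwardCost-<; forwardCost-≥; pairCost)

  cost-x-x : ∀ Z i k → cost Z (xv p q i) (xv p q k) ≡ 𝟙 (toℕ i <ᵇ toℕ k)
  cost-x-x Z i k rewrite FP.splitAt-↑ˡ p i q | FP.splitAt-↑ˡ p k q = refl

  cost-x-y : ∀ Z i j → cost Z (xv p q i) (yv p q j) ≡ xyCost i j
  cost-x-y Z i j rewrite FP.splitAt-↑ˡ p i q | FP.splitAt-↑ʳ p q j = refl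

  cost-y-x : ∀ Z j i → cost Z (yv p q j) (xv p q i) ≡ (if Z j then suc (xyCost i j) else 1 ∸ xyCost i j)
  cost-y-x Z j i rewrite FP.splitAt-↑ˡ p i q | FP.splitAt-↑ʳ p q j = refl

  cost-y-y : ∀ Z j k → cost Z (yv p q j) (yv p q k) ≡ (if Z j ∧ Z k then 0 else 𝟙 (toℕ j <ᵇ toℕ k))
  cost-y-y Z j k rewrite FP.splitAt-↑ʳ p q j | FP.splitAt-↑ʳ p q k = refl

  xyCost-notLast : ∀ i j → toℕ i ≢ p' → xyCost i j ≡ 1
  xyCost-notLast i j ne rewrite ≡ᵇ-false ne = refl

  y<x-late : ∀ j i → α ≤ toℕ i → ρ1 (yv p q j) < ρ1 (xv p q i)
  y<x-late j i α≤i = yx<1 {j} {i} (subst (ρ1y j <_) (sym (ρ1x-ge i α≤i))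
    (NP.<-≤-trans (NP.+-monoʳ-< α (FP.toℕ<n j)) (subst (_≤ q + toℕ i) (NP.+-comm q α) (NP.+-monoʳ-≤ q α≤i))))

  forward-x-x : ∀ Z i k → forwardCost Z (xv p q i) (xv p q k) ≡ 𝟙 (toℕ i <ᵇ toℕ k)
  forward-x-x Z i k with toℕ i NP.<? toℕ k
  ... | yes i<k = trans (forwardCost-< Z (xv p q i) (xv p q k) (x<1 {i} {k} (ρ1x-mono i<k))) (cost-x-x Z i k)
  ... | no i≮k rewrite <ᵇ-false (NP.≮⇒≥ i≮k) =
    forwardCost-≥ Z (xv p q i) (xv p q k) (subst₂ _≤_ (sym (rank-x ρ1x ρ1y k)) (sym (rank-x ρ1x ρ1y i)) ρk≤ρi)
    where
    ρk≤ρi : ρ1x k ≤ ρ1x i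
    ρk≤ρi with toℕ k NP.<? toℕ i
    ... | yes k<i = NP.<⇒≤ (ρ1x-mono k<i)
    ... | no k≮i = NP.≤-reflexive (cong ρ1x (FP.toℕ-injective (NP.≤-antisym (NP.≮⇒≥ i≮k) (NP.≮⇒≥ k≮i))))

  forward-x-y : ∀ Z i j → 𝟙 (toℕ i <ᵇ α) ≤ forwardCost Z (xv p q i) (yv p q j)
  forward-x-y Z i j with toℕ i NP.<? α
  ... | no i≮α rewrite <ᵇ-false (NP.≮⇒≥ i≮α) = z≤n
  ... | yes i<α rewrite <ᵇ-true i<α
                      | forwardCost-< Z (xv p q i) (yv p q j)
                          (xy<1 {i} {j} (subst (_< ρ1y j) (sym (ρ1x-lt i i<α)) (NP.<-≤-trans i<α (NP.m≤m+n α (toℕ j)))))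
                      | cost-x-y Z i j
                      | xyCost-notLast i j (λ e → NP.<-irrefl e (NP.<-≤-trans i<α α≤p')) = NP.≤-refl

  forward-y-y : ∀ Z j k → forwardCost Z (yv p q j) (yv p q k) ≡ (if toℕ j <ᵇ toℕ k then (if Z j ∧ Z k then 0 else 1) else 0)
  forward-y-y Z j k with toℕ j NP.<? toℕ k
  ... | yes j<k rewrite <ᵇ-true j<k =
    trans (forwardCost-< Z (yv p q j) (yv p q k) (y<1 {j} {k} (NP.+-monoʳ-< α j<k))) (trans (cost-y-y Z j k) (unmarked (Z j ∧ Z k)))
    where
    unmarked : ∀ b → (if b then 0 else 𝟙 (toℕ j <ᵇ toℕ k)) ≡ (if b then 0 else 1)
    unmarked true = refl
    unmarked false rewrite <ᵇ-true j<k = refl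
  ... | no j≮k rewrite <ᵇ-false (NP.≮⇒≥ j≮k) =
    forwardCost-≥ Z (yv p q j) (yv p q k) (subst₂ _≤_ (sym (rank-y ρ1x ρ1y k)) (sym (rank-y ρ1x ρ1y j)) (NP.+-monoʳ-≤ α (NP.≮⇒≥ j≮k)))

  twiceMarked : Marks → Fin q → ℕ
  twiceMarked Z j = if Z j then 2 else 0

  forward-y-x : ∀ Z j (k : Fin p') → twiceMarked Z j * 𝟙 (α ≤ᵇ toℕ k) ≤ forwardCost Z (yv p q j) (xv p q (F.inject₁ k))
  forward-y-x Z j k with α NP.≤? toℕ k
  ... | no α≰k rewrite ≤ᵇ-false α≰k = NP.≤-trans (NP.≤-reflexive (NP.*-zeroʳ (twiceMarked Z j))) z≤n
  ... | yes α≤k rewrite to BP.T-≡ (NP.≤⇒≤ᵇ α≤k) | NP.*-identityʳ (twiceMarked Z j) =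
    NP.≤-reflexive (sym (trans (forwardCost-< Z (yv p q j) (xv p q k') (y<x-late j k' (subst (α ≤_) (sym k'≡k) α≤k)))
                               (trans (cost-y-x Z j k') (twice (Z j)))))
    where
    k' = F.inject₁ k
    k'≡k : toℕ k' ≡ toℕ k
    k'≡k = FP.toℕ-inject₁ k
    xyCost≡1 : xyCost k' j ≡ 1
    xyCost≡1 = xyCost-notLast k' j (λ e → NP.<-irrefl (trans (sym k'≡k) e) (FP.toℕ<n k))
    twice : ∀ b → (if b then suc (xyCost k' j) else 1 ∸ xyCost k' j) ≡ (if b then 2 else 0)
    twice true rewrite xyCost≡1 = refl
    twice false rewrite xyCost≡1 = refl

  xyCostLast : Fin q → ℕ
  xyCostLast j = if toℕ j <ᵇ β then 0 else 1

  forward-y-xLast : ∀ Z j → forwardCost Z (yv p q j) (xv p q xLast) ≡ (if Z j then suc (xyCostLast j) else 1 ∸ xyCostLast j)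
  forward-y-xLast Z j =
    trans (forwardCost-< Z (yv p q j) (xv p q xLast) (y<x-late j xLast (subst (α ≤_) (sym toℕ-xLast) α≤p')))
          (trans (cost-y-x Z j xLast) (cong (λ c → if Z j then suc c else 1 ∸ c) xyCost≡))
    where
    toℕ-xLast : toℕ xLast ≡ p'
    toℕ-xLast = FP.toℕ-fromℕ p'
    xyCost≡ : xyCost xLast j ≡ xyCostLast j
    xyCost≡ rewrite toℕ-xLast | ≡ᵇ-true {p'} {p'} refl = refl

  yxRow : Marks → Fin q → ℕ
  yxRow Z j = ∑[ i < p ] forwardCost Z (yv p q j) (xv p q i)

  yxRow≥ : ∀ Z j → twiceMarked Z j * (p' ∸ α) + (if Z j then suc (xyCostLast j) else 1 ∸ xyCostLast j) ≤ yxRow Z j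
  yxRow≥ Z j = begin
      twiceMarked Z j * (p' ∸ α) + lastCost
    ≡⟨ cong (_+ lastCost) (trans (cong (twiceMarked Z j *_) (sym (count≥ p' α))) (*-distribˡ-sum {p'} (twiceMarked Z j) (λ k → 𝟙 (α ≤ᵇ toℕ k)))) ⟩
      ∑[ k < p' ] (twiceMarked Z j * 𝟙 (α ≤ᵇ toℕ k)) + lastCost
    ≤⟨ NP.+-mono-≤ (sum-mono-≤ (forward-y-x Z j)) (NP.≤-reflexive (sym (forward-y-xLast Z j))) ⟩
      ∑[ k < p' ] forwardCost Z (yv p q j) (xv p q (F.inject₁ k)) + forwardCost Z (yv p q j) (xv p q xLast)
    ≡⟨ sym (sum-init-last (λ i → forwardCost Z (yv p q j) (xv p q i))) ⟩
      yxRow Z j ∎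
    where
    open NP.≤-Reasoning
    lastCost = if Z j then suc (xyCostLast j) else 1 ∸ xyCostLast j

  d : ℕ
  d = p ∸ α

  d≡ : d ≡ suc (p' ∸ α)
  d≡ = NP.+-∸-assoc 1 α≤p'

  yxRow≥′ : ∀ Z j → 2 * d * 𝟙 (Z j) + 𝟙 (toℕ j <ᵇ β) ≤ yxRow Z j + 2 * 𝟙 (Z j ∧ (toℕ j <ᵇ β))
  yxRow≥′ Z j with yxRow≥ Z j
  ... | row≥ rewrite d≡ with Z j | toℕ j NP.<? β
  ...   | true | yes j<β rewrite <ᵇ-true j<β = NP.≤-trans (NP.≤-reflexive (identity (p' ∸ α))) (NP.+-monoˡ-≤ 2 row≥)
    where
    identity : ∀ m → 2 * suc m * 1 + 1 ≡ (2 * m + suc 0) + 2 * 1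
    identity = solve-∀
  ...   | true | no j≮β rewrite <ᵇ-false (NP.≮⇒≥ j≮β) = NP.≤-trans (NP.≤-reflexive (identity (p' ∸ α))) (NP.+-monoˡ-≤ 0 row≥)
    where
    identity : ∀ m → 2 * suc m * 1 + 0 ≡ (2 * m + suc 1) + 2 * 0
    identity = solve-∀
  ...   | false | yes j<β rewrite <ᵇ-true j<β = NP.≤-trans (NP.≤-reflexive (identity (p' ∸ α))) (NP.+-monoˡ-≤ 0 row≥)
    where
    identity : ∀ m → 2 * suc m * 0 + 1 ≡ (0 * m + 1) + 2 * 0
    identity = solve-∀
  ...   | false | no j≮β rewrite <ᵇ-false (NP.≮⇒≥ j≮β) = NP.≤-trans (NP.≤-reflexive (identity (p' ∸ α))) (NP.+-monoˡ-≤ 0 row≥)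
    where
    identity : ∀ m → 2 * suc m * 0 + 0 ≡ (0 * m + 0) + 2 * 0
    identity = solve-∀

  XX XY YX YY marked markedBelowβ : Marks → ℕ
  XX Z = ∑[ i < p ] ∑[ k < p ] forwardCost Z (xv p q i) (xv p q k)
  XY Z = ∑[ i < p ] ∑[ j < q ] forwardCost Z (xv p q i) (yv p q j)
  YX Z = ∑[ j < q ] yxRow Z j
  YY Z = ∑[ j < q ] ∑[ k < q ] forwardCost Z (yv p q j) (yv p q k)
  marked Z = ∑[ j < q ] 𝟙 (Z j)
  markedBelowβ Z = ∑[ j < q ] 𝟙 (Z j ∧ (toℕ j <ᵇ β))

  pairCost-blocks : ∀ Z → pairCost Z ⊤ ≡ (XX Z + XY Z) + (YX Z + YY Z)
  pairCost-blocks Z =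
    trans (sumₛ-⊤ (λ a → sumₛ ⊤ (forwardCost Z a)))
    (trans (sum-cong-≗ (λ a → trans (sumₛ-⊤ (forwardCost Z a)) (sum-↑ p q (forwardCost Z a))))
    (trans (sum-↑ p q (λ a → ∑[ i < p ] forwardCost Z a (xv p q i) + ∑[ j < q ] forwardCost Z a (yv p q j)))
    (cong₂ _+_ (∑-distrib-+ (λ i → ∑[ k < p ] forwardCost Z (xv p q i) (xv p q k)) (λ i → ∑[ j < q ] forwardCost Z (xv p q i) (yv p q j)))
               (∑-distrib-+ (λ j → ∑[ i < p ] forwardCost Z (yv p q j) (xv p q i)) (λ j → ∑[ k < q ] forwardCost Z (yv p q j) (yv p q k))))))

  XX≡ : ∀ Z → XX Z ≡ pairs p
  XX≡ Z = trans (sum-cong-≗ (λ i → sum-cong-≗ (λ k → forward-x-x Z i k))) (sum<-1 p)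

  XY≥ : ∀ Z → α * q ≤ XY Z
  XY≥ Z = begin
      α * q
    ≡⟨ NP.*-comm α q ⟩
      q * α
    ≡⟨ cong (q *_) (sym (trans (count< p α) (NP.m≥n⇒m⊓n≡n (NP.≤-trans α≤p' (NP.n≤1+n p'))))) ⟩
      q * ∑[ i < p ] 𝟙 (toℕ i <ᵇ α)
    ≡⟨ *-distribˡ-sum {p} q (λ i → 𝟙 (toℕ i <ᵇ α)) ⟩
      ∑[ i < p ] (q * 𝟙 (toℕ i <ᵇ α))
    ≡⟨ sum-cong-≗ {p} (λ i → sym (sum-const q (𝟙 (toℕ i <ᵇ α)))) ⟩
      ∑[ i < p ] ∑[ j < q ] 𝟙 (toℕ i <ᵇ α)
    ≤⟨ sum-mono-≤ (λ i → sum-mono-≤ (forward-x-y Z i)) ⟩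
      XY Z ∎
    where open NP.≤-Reasoning

  YY≡ : ∀ Z → YY Z + pairs (marked Z) ≡ pairs q
  YY≡ Z = begin
      YY Z + pairs (marked Z)
    ≡⟨ cong₂ _+_ (sum-cong-≗ (λ j → sum-cong-≗ (λ k → forward-y-y Z j k))) (sym (sum<-both q Z)) ⟩
      sum< q (λ j k → if Z j ∧ Z k then 0 else 1) + sum< q (λ j k → 𝟙 (Z j ∧ Z k))
    ≡⟨ sym (sum<-+ q _ _) ⟩
      sum< q (λ j k → (if Z j ∧ Z k then 0 else 1) + 𝟙 (Z j ∧ Z k))
    ≡⟨ sum<-cong q (λ j k → complement (Z j ∧ Z k)) ⟩
      sum< q (λ _ _ → 1)
    ≡⟨ sum<-1 q ⟩
      pairs q ∎
    where
    open ≡-Reasoning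
    complement : ∀ b → (if b then 0 else 1) + 𝟙 b ≡ 1
    complement true = refl
    complement false = refl

  count<β : ∑[ j < q ] 𝟙 (toℕ j <ᵇ β) ≡ β
  count<β = trans (count< q β) (NP.m≥n⇒m⊓n≡n (NP.<⇒≤ β<q))

  YX≥ : ∀ Z → 2 * d * marked Z + β ≤ YX Z + 2 * markedBelowβ Z
  YX≥ Z = begin
      2 * d * marked Z + β
    ≡⟨ cong₂ _+_ (*-distribˡ-sum {q} (2 * d) (λ j → 𝟙 (Z j))) (sym count<β) ⟩
      ∑[ j < q ] (2 * d * 𝟙 (Z j)) + ∑[ j < q ] 𝟙 (toℕ j <ᵇ β)
    ≡⟨ sym (∑-distrib-+ {q} (λ j → 2 * d * 𝟙 (Z j)) (λ j → 𝟙 (toℕ j <ᵇ β))) ⟩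
      ∑[ j < q ] (2 * d * 𝟙 (Z j) + 𝟙 (toℕ j <ᵇ β))
    ≤⟨ sum-mono-≤ (yxRow≥′ Z) ⟩
      ∑[ j < q ] (yxRow Z j + 2 * 𝟙 (Z j ∧ (toℕ j <ᵇ β)))
    ≡⟨ trans (∑-distrib-+ {q} (yxRow Z) (λ j → 2 * 𝟙 (Z j ∧ (toℕ j <ᵇ β)))) (cong (YX Z +_) (sym (*-distribˡ-sum {q} 2 (λ j → 𝟙 (Z j ∧ (toℕ j <ᵇ β)))))) ⟩
      YX Z + 2 * markedBelowβ Z ∎
    where open NP.≤-Reasoning

  pairCost-bound : ∀ Z → bound p q α β ≤ pairCost Z ⊤
  pairCost-bound Z = begin
      p C 2 + α * q + ((q C 2 + β) ⊓ (2 * q * (p ∸ α) ∸ β))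
    ≡⟨ cong₂ (λ a b → a + α * q + ((b + β) ⊓ (2 * q * d ∸ β))) (sym (pairs≡C2 p)) (sym (pairs≡C2 q)) ⟩
      pairs p + α * q + ((pairs q + β) ⊓ (2 * q * d ∸ β))
    ≤⟨ NP.+-mono-≤ (NP.+-mono-≤ (NP.≤-reflexive (sym (XX≡ Z))) (XY≥ Z))
         (min-bound d (marked Z) (markedBelowβ Z) q β (YX Z) (YY Z) (subst (1 ≤_) (sym d≡) (s≤s z≤n))
                    marked≤q (sum-mono-≤ (λ j → 𝟙-∧ˡ (Z j) _)) markedBelowβ≤β (YX≥ Z) (NP.≤-reflexive (sym (YY≡ Z)))) ⟩
      (XX Z + XY Z) + (YX Z + YY Z)
    ≡⟨ sym (pairCost-blocks Z) ⟩
      pairCost Z ⊤ ∎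
    where
    open NP.≤-Reasoning
    marked≤q : marked Z ≤ q
    marked≤q = NP.≤-trans (sum-mono-≤ (λ j → 𝟙≤1 (Z j))) (NP.≤-reflexive (trans (sum-const q 1) (NP.*-identityʳ q)))
    markedBelowβ≤β : markedBelowβ Z ≤ β
    markedBelowβ≤β = NP.≤-trans (sum-mono-≤ (λ j → 𝟙-∧ʳ (Z j) _)) (NP.≤-reflexive count<β)

lemma22 : (p q α β : ℕ) → 0 < p → 0 < q → α < p → β < q
    → (T₁ T₂ : Tree (p + q))
    → Assoc (SPKAdj p q) (order1 p q α) ⊤ T₁
    → Assoc (SPKAdj p q) (order2 p q β) ⊤ T₂
    → DistAtLeast (SPKAdj p q) T₁ T₂ (bound p q α β)
lemma22 (suc p') q α β _ _ α<p β<q T₁ T₂ assoc₁ assoc₂ m path =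
  bound≤m (rotationPath-Φ path (assoc⇒st assoc₁) hasX Z₀ T₂-marked)
  where
  open LowerBound p' q α β β<q (s≤s⁻¹ α<p)
  module O₂ = Ordered p q β ρ2 (order2 p q β) sorted2 complete2

  hasX : HasX ⊤
  hasX = xv p q xFirst , SP.∈⊤ , xFirst , FP.splitAt-↑ˡ p xFirst q

  T₂-marked : LeavesMarked Z₀ T₂
  T₂-marked = O₂.assoc-LeavesMarked Z₀ assoc₂ hasX O₂.FinalSegment-⊤ Z₀-marksLateY

  bound≤m : (∃ λ Z → LeavesMarked Z T₁ × Φ Z T₁ ≤ m + Φ Z₀ T₂) → bound p q α β ≤ m
  bound≤m (Z , _ , Φ≤) = begin
      bound p q α β   ≤⟨ pairCost-bound Z ⟩
      O₁.pairCost Z ⊤ ≡⟨ O₁.Φ≡pairCost Z assoc₁ O₁.FinalSegment-⊤ (xv p q xLast) (xLast , FP.splitAt-↑ˡ p xLast q) ρ1≤xLast ⟨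
      Φ Z T₁          ≤⟨ Φ≤ ⟩
      m + Φ Z₀ T₂     ≡⟨ cong (m +_) (O₂.Φ≡0 Z₀ assoc₂ cost-Z₀) ⟩
      m + 0           ≡⟨ NP.+-identityʳ m ⟩
      m               ∎
    where open NP.≤-Reasoning
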